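{- Let $1/n\ll\alpha\ll\eta\ll\gamma\ll1/k\le1/4$. Let $G$ be a $k$-graph on $n$ vertices with $\alpha$-perturbed minimum relative $(k-2)$-degree at least $\tfrac12+\gamma$, and let $\omega:V(G)\to[0,1]$ satisfy $\sum_{v\in V(G)}\omega(v)\ge(1-\eta)n$ and $\omega(v)=0$ for all isolated vertices $v$ of $G$. Let $A\in E(\partial_{k-2}(G))$. Then there is an $\omega$-fractional matching of size at least $n/4$ in $C_A$.
   Context: A $k$-graph is a hypergraph whose edges have $k$ vertices. For $1\le j\le k$, $\partial_j(G)$ is the $j$-graph of $j$-sets contained in some edge of $G$ ($\partial_0(G)=\{\emptyset\}$), with complement $\overline{\partial_j(G)}$; relative degree of a $j$-set $S$ is $\deg_G(S)/\binom{n}{k-j}$. $G$ has $\alpha$-perturbed minimum relative $\ell$-degree at least $\delta$ if for every $j\in[\ell]$: every edge of $\partial_j(G)$ has relative degree at least $\delta$ in $G$; $\overline{\partial_j(G)}$ has edge density at most $\alpha$; every edge of $\partial_{j-1}(G)$ has relative degree less than $\alpha$ in $\overline{\partial_j(G)}$. For $A\in E(\partial_{k-2}(G))$, the link graph $L_G(A)$ is the $2$-graph of pairs $uv$ with $A\cup uv\in E(G)$, and $C_A$ is the subgraph induced by its largest connected component. An $\omega$-fractional matching of a graph $H$ is $\omega^*:E(H)\to[0,1]$ with $\sum_{e\ni v}\omega^*(e)\le\omega(v)$ for every vertex $v$; its size is $\sum_e\omega^*(e)$. The notation $a\ll b$ means the statement holds whenever $a<f(b)$ for a suitable non-decreasing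 $f$.
   Formalization: The weight function ω takes rational values in [0,1], the parameters α, η and γ are rational, and the fractional matching is taken with rational values. -}

module Defs where

open import Data.Bool using (Bool; true; false; _∧_; _∨_; not; T; if_then_else_)
open import Data.Nat as ℕ using (ℕ; zero; suc; _∸_)
open import Data.Nat.Combinatorics using (_C_)
open import Data.Fin using (Fin)
open import Data.Fin.Subset using (Subset; ∣_∣; _∪_; ⁅_⁆; _∈_; ⊥)
open import Data.Vec using (Vec; []; _∷_)
open import Data.List using (List; []; _∷_; map; _++_; filter; length; foldr)
open import Data.Integer using (+_)
open import Data.Rational using (ℚ; _/_; _+_; _*_; _≤_; _<_; 0ℚ; 1ℚ; ½; _-_)
open import Data.Product using (Σ; _×_; ∃; _,_)
open import Relation.Nullary using (¬_)
open import Relation.Binary.PropositionalEquality using (_≡_)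
open import Function.Bundles using (_⇔_)

ℕ→ℚ : ℕ → ℚ
ℕ→ℚ m = (+ m) / 1

allSubsets : (n : ℕ) → List (Subset n)
allSubsets zero = [] ∷ []
allSubsets (suc n) = map (true ∷_) (allSubsets n) ++ map (false ∷_) (allSubsets n)

_⊆ᵇ_ : ∀ {n} → Subset n → Subset n → Bool
[] ⊆ᵇ [] = true
(true ∷ s) ⊆ᵇ (false ∷ t) = false
(_ ∷ s) ⊆ᵇ (_ ∷ t) = s ⊆ᵇ t

SetSys : ℕ → Set
SetSys n = Subset n → Bool

count : ∀ {n} → SetSys n → ℕ
count {n} H = length (filter (λ S → T? (H S)) (allSubsets n))
  where
  open import Relation.Nullary.Decidable using (Dec)
  open import Data.Bool.Properties using (T?)

deg : ∀ {n} → SetSys n → Subset n → ℕ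
deg H S = count (λ X → H X ∧ (S ⊆ᵇ X))

sumOver : ∀ {n} → SetSys n → (Subset n → ℚ) → ℚ
sumOver {n} H f = foldr (λ S acc → (if H S then f S else 0ℚ) + acc) 0ℚ (allSubsets n)

sumV : ∀ {n} → (Fin n → ℚ) → ℚ
sumV {zero} f = 0ℚ
sumV {suc n} f = f Fin.zero + sumV (λ i → f (Fin.suc i))
  where import Data.Fin as Fin

_==_ : ℕ → ℕ → Bool
m == n = Relation.Nullary.Decidable.⌊ m ℕ.≟ n ⌋
  where import Relation.Nullary.Decidable

record KGraph (n k : ℕ) : Set where
  field
    edge    : SetSys n
    uniform : ∀ S → T (edge S) → ∣ S ∣ ≡ k
open KGraph public

shadow : ∀ {n k} → KGraph n k → ℕ → SetSys n
shadow G zero S = zero == ∣ S ∣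
shadow {n} G (suc j) S =
  (suc j == ∣ S ∣) ∧ Data.Bool.ListAction.any (λ e → edge G e ∧ (S ⊆ᵇ e)) (allSubsets n)
  where import Data.Bool.ListAction

coShadow : ∀ {n k} → KGraph n k → ℕ → SetSys n
coShadow G j S = (j == ∣ S ∣) ∧ not (shadow G j S)

RelDegGE : ∀ {n} → ℕ → SetSys n → Subset n → ℚ → Set
RelDegGE {n} r H S δ = δ * ℕ→ℚ (n C (r ∸ ∣ S ∣)) ≤ ℕ→ℚ (deg H S)

RelDegLT : ∀ {n} → ℕ → SetSys n → Subset n → ℚ → Set
RelDegLT {n} r H S α = ℕ→ℚ (deg H S) < α * ℕ→ℚ (n C (r ∸ ∣ S ∣))

DensityLE : ∀ {n} → ℕ → SetSys n → ℚ → Set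
DensityLE {n} j H α = ℕ→ℚ (count H) ≤ α * ℕ→ℚ (n C j)

PerturbedMinDeg : ∀ {n k} → KGraph n k → ℚ → ℕ → ℚ → Set
PerturbedMinDeg {n} {k} G α ℓ δ =
  ∀ j → 1 ℕ.≤ j → j ℕ.≤ ℓ →
    (∀ S → T (shadow G j S) → RelDegGE k (edge G) S δ)
    × DensityLE j (coShadow G j) α
    × (∀ S → T (shadow G (j ∸ 1) S) → RelDegLT j (coShadow G j) S α)

Isolated : ∀ {n k} → KGraph n k → Fin n → Set
Isolated G v = ∀ e → T (edge G e) → ¬ (v ∈ e)

link : ∀ {n k} → KGraph n k → Subset n → SetSys n
link G A e = (2 == ∣ e ∣) ∧ edge G (A ∪ e)

data Reach {n} (L : SetSys n) : Fin n → Fin n → Set where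
  here : ∀ {u} → Reach L u u
  step : ∀ {u v w} → T (L (⁅ u ⁆ ∪ ⁅ v ⁆)) → Reach L v w → Reach L u w

IsComponent : ∀ {n} → SetSys n → Subset n → Set
IsComponent {n} L C = Σ (Fin n) λ u → u ∈ C × (∀ v → (v ∈ C) ⇔ Reach L u v)

IsLargestComponent : ∀ {n} → SetSys n → Subset n → Set
IsLargestComponent L C = IsComponent L C × (∀ D → IsComponent L D → ∣ D ∣ ℕ.≤ ∣ C ∣)

induced : ∀ {n} → SetSys n → Subset n → SetSys n
induced L C e = L e ∧ (e ⊆ᵇ C)

IsFracMatching : ∀ {n} → SetSys n → (Fin n → ℚ) → (Subset n → ℚ) → Set
IsFracMatching H ω ω* =
  (∀ e → T (H e) → (0ℚ ≤ ω* e × ω* e ≤ 1ℚ))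
  × (∀ v → sumOver (λ e → H e ∧ (⁅ v ⁆ ⊆ᵇ e)) ω* ≤ ω v)

fmSize : ∀ {n} → SetSys n → (Subset n → ℚ) → ℚ
fmSize H ω* = sumOver H ω*

-- Let L be the link graph of A, with at least (½ + γ)·C(n,2) edges, and C a largest component of L, with
-- M vertices; K = n - M. Every vertex has fewer than M neighbours (its own component is no larger than C),
-- and a vertex outside C also has fewer than K, so at most n/2. Hence the edges meeting ∁ C number at most
-- Kn/4, and 4·e(L[C]) ≥ n(M - 1) + 2γn(n - 1); as 2·e(L[C]) ≤ n(M - 1), this forces M ≥ 2.
-- Giving each edge e of L[C] the weight ∏_{v ∈ e} ω(v) / (M - 1) yields an ω-fractional matching, since
-- degrees in L[C] are at most M - 1. By the Weierstrass product inequality its size is at least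
-- (e(L[C]) - (M - 1)·Σ_v (1 - ω(v))) / (M - 1), which is at least n/4 because Σ_v (1 - ω(v)) ≤ ηn and 4η ≤ γ.
-- Only the minimum relative (k - 2)-degree condition is needed: neither the perturbation α nor the
-- condition on isolated vertices enters the argument.

module Submission where

open import Defs
open import Data.Nat using (ℕ; _∸_; _≡ᵇ_) renaming (_≤_ to _≤ℕ_)
import Data.Nat as ℕ
import Data.Nat.Properties as ℕ
import Data.Nat.Combinatorics as Comb
open Comb using (nCk+nC[k+1]≡[n+1]C[k+1]; nC1≡n)
open import Data.Nat.Coprimality using (1-coprimeTo)
import Data.Nat.Coprimality as Coprime
import Data.Integer as ℤ
import Data.Integer.Properties as ℤ
open import Data.Rational
  using (ℚ; mkℚ; _/_; _+_; _*_; _-_; -_; 1/_; _≤_; _<_; *≤*; 0ℚ; 1ℚ; ½; NonZero; Positive; nonNegative; positive)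
import Data.Rational.Properties as ℚ
open import Data.Rational.Solver using (module +-*-Solver)
open +-*-Solver using (solve; _:+_; _:*_; _:-_; :-_; _:=_; con)
open import Data.Fin using (Fin; zero; suc)
open import Data.Fin.Properties using (any?)
open import Data.Fin.Subset using (Subset; ∣_∣; ⁅_⁆; _∪_; _∈_; ∁; ⊥)
import Data.Fin.Subset.Properties as Subset
open import Data.Bool using (Bool; true; false; T; if_then_else_; _∧_; _∨_; not)
import Data.Bool.Properties as Bool
open import Data.Vec using ([]; _∷_; lookup; tabulate)
import Data.Vec.Properties as Vec
open import Data.List using (List; []; _∷_; foldr; map; _++_; filter; length)
open import Data.Product using (Σ; _×_; _,_; proj₁; proj₂)
open import Data.Sum using (_⊎_; inj₁; inj₂)
open import Data.Empty using (⊥-elim)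
open import Data.Unit using (tt)
open import Function.Bundles using (Equivalence; mk⇔)
open Equivalence using (to; from)
open import Relation.Nullary using (yes; no)
open import Relation.Nullary.Decidable using (⌊⌋-map′; isYes≗does; isYes; toWitness; fromWitness)
open import Relation.Binary.PropositionalEquality
  using (_≡_; _≢_; refl; sym; trans; cong; cong₂; subst; subst₂; module ≡-Reasoning)

ℕ→ℚ≡mkℚ : ∀ m → ℕ→ℚ m ≡ mkℚ (ℤ.+ m) 0 (Coprime.sym (1-coprimeTo m))
ℕ→ℚ≡mkℚ m = ℚ.↥p/↧p≡p (mkℚ (ℤ.+ m) 0 _)

ℕ→ℚ-+ : ∀ a b → ℕ→ℚ (a ℕ.+ b) ≡ ℕ→ℚ a + ℕ→ℚ b
ℕ→ℚ-+ a b = sym (trans (cong₂ _+_ (ℕ→ℚ≡mkℚ a) (ℕ→ℚ≡mkℚ b))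
  (cong₂ (λ x y → (x ℤ.+ y) / 1) (ℤ.*-identityʳ (ℤ.+ a)) (ℤ.*-identityʳ (ℤ.+ b))))

ℕ→ℚ-suc : ∀ a → ℕ→ℚ (ℕ.suc a) ≡ 1ℚ + ℕ→ℚ a
ℕ→ℚ-suc = ℕ→ℚ-+ 1

ℕ→ℚ-mono-≤ : ∀ {a b} → a ≤ℕ b → ℕ→ℚ a ≤ ℕ→ℚ b
ℕ→ℚ-mono-≤ {a} {b} a≤b = subst₂ _≤_ (sym (ℕ→ℚ≡mkℚ a)) (sym (ℕ→ℚ≡mkℚ b))
  (*≤* (ℤ.*-monoʳ-≤-nonNeg (ℤ.+ 1) (ℤ.+≤+ a≤b)))

ℕ→ℚ-nonNeg : ∀ a → 0ℚ ≤ ℕ→ℚ a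
ℕ→ℚ-nonNeg a = ℕ→ℚ-mono-≤ (ℕ.z≤n {a})

2ℚ 4ℚ : ℚ
2ℚ = ℕ→ℚ 2
4ℚ = ℕ→ℚ 4

2*nC2≡n*[n-1] : ∀ n → 2ℚ * ℕ→ℚ (n Comb.C 2) ≡ ℕ→ℚ n * (ℕ→ℚ n - 1ℚ)
2*nC2≡n*[n-1] ℕ.zero = refl
2*nC2≡n*[n-1] (ℕ.suc m) = begin
  2ℚ * ℕ→ℚ (ℕ.suc m Comb.C 2)
    ≡⟨ cong (λ z → 2ℚ * ℕ→ℚ z) (sym (nCk+nC[k+1]≡[n+1]C[k+1] m 1)) ⟩
  2ℚ * ℕ→ℚ (m Comb.C 1 ℕ.+ m Comb.C 2)
    ≡⟨ cong (2ℚ *_) (trans (ℕ→ℚ-+ (m Comb.C 1) (m Comb.C 2))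
                           (cong (λ z → ℕ→ℚ z + ℕ→ℚ (m Comb.C 2)) (nC1≡n m))) ⟩
  2ℚ * (ℕ→ℚ m + ℕ→ℚ (m Comb.C 2))
    ≡⟨ ℚ.*-distribˡ-+ 2ℚ (ℕ→ℚ m) _ ⟩
  2ℚ * ℕ→ℚ m + 2ℚ * ℕ→ℚ (m Comb.C 2)
    ≡⟨ cong (λ z → 2ℚ * ℕ→ℚ m + z) (2*nC2≡n*[n-1] m) ⟩
  2ℚ * ℕ→ℚ m + ℕ→ℚ m * (ℕ→ℚ m - 1ℚ)
    ≡⟨ solve 1 (λ x → con 2ℚ :* x :+ x :* (x :- con 1ℚ)
                    := (con 1ℚ :+ x) :* ((con 1ℚ :+ x) :- con 1ℚ)) refl (ℕ→ℚ m) ⟩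
  (1ℚ + ℕ→ℚ m) * ((1ℚ + ℕ→ℚ m) - 1ℚ)
    ≡⟨ cong (λ z → z * (z - 1ℚ)) (sym (ℕ→ℚ-suc m)) ⟩
  ℕ→ℚ (ℕ.suc m) * (ℕ→ℚ (ℕ.suc m) - 1ℚ) ∎
  where open ≡-Reasoning

0≤1 : 0ℚ ≤ 1ℚ
0≤1 = ℚ.<⇒≤ (ℚ.positive⁻¹ 1ℚ)

0≤q-p⇒p≤q : ∀ p q → 0ℚ ≤ q - p → p ≤ q
0≤q-p⇒p≤q p q h = subst₂ _≤_ (ℚ.+-identityʳ p) (solve 2 (λ p q → p :+ (q :- p) := q) refl p q) (ℚ.+-monoʳ-≤ p h)

p≤q⇒0≤q-p : ∀ p q → p ≤ q → 0ℚ ≤ q - p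
p≤q⇒0≤q-p p q h = subst (_≤ q - p) (ℚ.+-inverseʳ p) (ℚ.+-monoˡ-≤ (- p) h)

≤-by-difference : ∀ p q d → q - p ≡ d → 0ℚ ≤ d → p ≤ q
≤-by-difference p q d q-p≡d 0≤d = 0≤q-p⇒p≤q p q (subst (0ℚ ≤_) (sym q-p≡d) 0≤d)

0≤+ : ∀ {p q} → 0ℚ ≤ p → 0ℚ ≤ q → 0ℚ ≤ p + q
0≤+ = ℚ.+-mono-≤

0≤* : ∀ {p q} → 0ℚ ≤ p → 0ℚ ≤ q → 0ℚ ≤ p * q
0≤* {p} {q} 0≤p 0≤q = subst (_≤ p * q) (ℚ.*-zeroʳ p) (ℚ.*-monoˡ-≤-nonNeg p {{nonNegative 0≤p}} 0≤q)

0<* : ∀ {p q} → 0ℚ < p → 0ℚ < q → 0ℚ < p * q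
0<* {p} {q} 0<p 0<q = subst (_< p * q) (ℚ.*-zeroˡ q) (ℚ.*-monoˡ-<-pos q {{positive 0<q}} 0<p)

*-monoˡ-≤-0≤ : ∀ {r p q} → 0ℚ ≤ r → p ≤ q → r * p ≤ r * q
*-monoˡ-≤-0≤ {r} 0≤r = ℚ.*-monoˡ-≤-nonNeg r {{nonNegative 0≤r}}

*-monoʳ-≤-0≤ : ∀ {r p q} → 0ℚ ≤ r → p ≤ q → p * r ≤ q * r
*-monoʳ-≤-0≤ {r} 0≤r = ℚ.*-monoʳ-≤-nonNeg r {{nonNegative 0≤r}}

p+1≤q⇒p≤q-1 : ∀ p q → p + 1ℚ ≤ q → p ≤ q - 1ℚ
p+1≤q⇒p≤q-1 p q h = ≤-by-difference p (q - 1ℚ) (q - (p + 1ℚ))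
  (solve 2 (λ p q → (q :- con 1ℚ) :- p := q :- (p :+ con 1ℚ)) refl p q) (p≤q⇒0≤q-p _ _ h)

module _ {X : Set} where

  sumL : List X → (X → ℚ) → ℚ
  sumL xs f = foldr (λ x acc → f x + acc) 0ℚ xs

  sumL-cong : ∀ xs {f g : X → ℚ} → (∀ x → f x ≡ g x) → sumL xs f ≡ sumL xs g
  sumL-cong [] e = refl
  sumL-cong (x ∷ xs) e = cong₂ _+_ (e x) (sumL-cong xs e)

  sumL-mono-≤ : ∀ xs {f g : X → ℚ} → (∀ x → f x ≤ g x) → sumL xs f ≤ sumL xs g
  sumL-mono-≤ [] e = ℚ.≤-refl
  sumL-mono-≤ (x ∷ xs) e = ℚ.+-mono-≤ (e x) (sumL-mono-≤ xs e)

  sumL-0 : ∀ xs → sumL xs (λ _ → 0ℚ) ≡ 0ℚ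
  sumL-0 [] = refl
  sumL-0 (x ∷ xs) = trans (ℚ.+-identityˡ _) (sumL-0 xs)

  sumL-+ : ∀ xs (f g : X → ℚ) → sumL xs (λ x → f x + g x) ≡ sumL xs f + sumL xs g
  sumL-+ [] f g = refl
  sumL-+ (x ∷ xs) f g rewrite sumL-+ xs f g =
    solve 4 (λ a b c d → (a :+ b) :+ (c :+ d) := (a :+ c) :+ (b :+ d)) refl (f x) (g x) (sumL xs f) (sumL xs g)

  sumL-neg : ∀ xs (f : X → ℚ) → sumL xs (λ x → - f x) ≡ - sumL xs f
  sumL-neg [] f = refl
  sumL-neg (x ∷ xs) f rewrite sumL-neg xs f = sym (ℚ.neg-distrib-+ (f x) (sumL xs f))

  sumL-- : ∀ xs (f g : X → ℚ) → sumL xs (λ x → f x - g x) ≡ sumL xs f - sumL xs g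
  sumL-- xs f g = trans (sumL-+ xs f (λ x → - g x)) (cong (sumL xs f +_) (sumL-neg xs g))

  sumL-*ˡ : ∀ xs c (f : X → ℚ) → sumL xs (λ x → c * f x) ≡ c * sumL xs f
  sumL-*ˡ [] c f = sym (ℚ.*-zeroʳ c)
  sumL-*ˡ (x ∷ xs) c f rewrite sumL-*ˡ xs c f = sym (ℚ.*-distribˡ-+ c (f x) (sumL xs f))

  sumL-*ʳ : ∀ xs (f : X → ℚ) c → sumL xs (λ x → f x * c) ≡ sumL xs f * c
  sumL-*ʳ xs f c = trans (sumL-cong xs (λ x → ℚ.*-comm (f x) c))
    (trans (sumL-*ˡ xs c f) (ℚ.*-comm c (sumL xs f)))

  sumL-++ : ∀ xs ys (f : X → ℚ) → sumL (xs ++ ys) f ≡ sumL xs f + sumL ys f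
  sumL-++ [] ys f = sym (ℚ.+-identityˡ _)
  sumL-++ (x ∷ xs) ys f rewrite sumL-++ xs ys f = sym (ℚ.+-assoc (f x) (sumL xs f) (sumL ys f))

sumL-map : ∀ {X Y : Set} (g : X → Y) xs (f : Y → ℚ) → sumL (map g xs) f ≡ sumL xs (λ x → f (g x))
sumL-map g [] f = refl
sumL-map g (x ∷ xs) f = cong (f (g x) +_) (sumL-map g xs f)

sumV-cong : ∀ {n} {f g : Fin n → ℚ} → (∀ v → f v ≡ g v) → sumV f ≡ sumV g
sumV-cong {ℕ.zero} e = refl
sumV-cong {ℕ.suc n} e = cong₂ _+_ (e zero) (sumV-cong (λ v → e (suc v)))

sumV-mono-≤ : ∀ {n} {f g : Fin n → ℚ} → (∀ v → f v ≤ g v) → sumV f ≤ sumV g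
sumV-mono-≤ {ℕ.zero} e = ℚ.≤-refl
sumV-mono-≤ {ℕ.suc n} e = ℚ.+-mono-≤ (e zero) (sumV-mono-≤ (λ v → e (suc v)))

sumV-0 : ∀ {n} → sumV {n} (λ _ → 0ℚ) ≡ 0ℚ
sumV-0 {ℕ.zero} = refl
sumV-0 {ℕ.suc n} = trans (ℚ.+-identityˡ _) (sumV-0 {n})

sumV-+ : ∀ {n} (f g : Fin n → ℚ) → sumV (λ v → f v + g v) ≡ sumV f + sumV g
sumV-+ {ℕ.zero} f g = refl
sumV-+ {ℕ.suc n} f g rewrite sumV-+ (λ v → f (suc v)) (λ v → g (suc v)) =
  solve 4 (λ a b c d → (a :+ b) :+ (c :+ d) := (a :+ c) :+ (b :+ d)) refl
    (f zero) (g zero) (sumV (λ v → f (suc v))) (sumV (λ v → g (suc v)))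

sumV-neg : ∀ {n} (f : Fin n → ℚ) → sumV (λ v → - f v) ≡ - sumV f
sumV-neg {ℕ.zero} f = refl
sumV-neg {ℕ.suc n} f rewrite sumV-neg (λ v → f (suc v)) = sym (ℚ.neg-distrib-+ (f zero) _)

sumV-*ˡ : ∀ {n} c (f : Fin n → ℚ) → sumV (λ v → c * f v) ≡ c * sumV f
sumV-*ˡ {ℕ.zero} c f = sym (ℚ.*-zeroʳ c)
sumV-*ˡ {ℕ.suc n} c f rewrite sumV-*ˡ c (λ v → f (suc v)) = sym (ℚ.*-distribˡ-+ c (f zero) _)

sumV-1 : ∀ {n} → sumV {n} (λ _ → 1ℚ) ≡ ℕ→ℚ n
sumV-1 {ℕ.zero} = refl
sumV-1 {ℕ.suc n} = trans (cong (1ℚ +_) (sumV-1 {n})) (sym (ℕ→ℚ-suc n))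

sumV-const : ∀ {n} c → sumV {n} (λ _ → c) ≡ c * ℕ→ℚ n
sumV-const {n} c = trans (sumV-cong {n} (λ _ → sym (ℚ.*-identityʳ c)))
  (trans (sumV-*ˡ {n} c (λ _ → 1ℚ)) (cong (c *_) (sumV-1 {n})))

sumL-sumV-comm : ∀ {n} {X : Set} xs (f : Fin n → X → ℚ) →
  sumL xs (λ x → sumV (λ v → f v x)) ≡ sumV (λ v → sumL xs (f v))
sumL-sumV-comm {n} [] f = sym (sumV-0 {n})
sumL-sumV-comm (x ∷ xs) f rewrite sumL-sumV-comm xs f = sym (sumV-+ (λ v → f v x) (λ v → sumL xs (f v)))

𝟙 : Bool → ℚ
𝟙 b = if b then 1ℚ else 0ℚ

𝟙-nonNeg : ∀ b → 0ℚ ≤ 𝟙 b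
𝟙-nonNeg true = 0≤1
𝟙-nonNeg false = ℚ.≤-refl

𝟙-mono-≤ : ∀ a b → (T a → T b) → 𝟙 a ≤ 𝟙 b
𝟙-mono-≤ false b _ = 𝟙-nonNeg b
𝟙-mono-≤ true b h with b | h tt
... | true | _ = ℚ.≤-refl

𝟙-not+𝟙 : ∀ b → 𝟙 (not b) + 𝟙 b ≡ 1ℚ
𝟙-not+𝟙 true = refl
𝟙-not+𝟙 false = refl

sumS : ∀ {n} → (Subset n → ℚ) → ℚ
sumS {n} = sumL (allSubsets n)

sumS-split : ∀ {n} (f : Subset (ℕ.suc n) → ℚ) →
  sumS f ≡ sumS (λ S → f (true ∷ S)) + sumS (λ S → f (false ∷ S))
sumS-split {n} f = trans (sumL-++ (map (true ∷_) (allSubsets n)) _ f)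
  (cong₂ _+_ (sumL-map (true ∷_) (allSubsets n) f) (sumL-map (false ∷_) (allSubsets n) f))

countℚ : ∀ {n} → SetSys n → ℚ
countℚ P = sumS (λ S → 𝟙 (P S))

count≡countℚ : ∀ {n} (P : SetSys n) → ℕ→ℚ (count P) ≡ countℚ P
count≡countℚ {n} P = go (allSubsets n)
  where
  go : ∀ xs → ℕ→ℚ (length (filter (λ S → Bool.T? (P S)) xs)) ≡ sumL xs (λ S → 𝟙 (P S))
  go [] = refl
  go (x ∷ xs) with P x
  ... | true = trans (ℕ→ℚ-suc (length (filter (λ S → Bool.T? (P S)) xs))) (cong (1ℚ +_) (go xs))
  ... | false = trans (go xs) (sym (ℚ.+-identityˡ _))

countℚ-split : ∀ {n} (P : SetSys (ℕ.suc n)) →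
  countℚ P ≡ countℚ (λ S → P (true ∷ S)) + countℚ (λ S → P (false ∷ S))
countℚ-split P = sumS-split (λ S → 𝟙 (P S))

countℚ-cong : ∀ {n} {P Q : SetSys n} → (∀ S → P S ≡ Q S) → countℚ P ≡ countℚ Q
countℚ-cong {n} e = sumL-cong (allSubsets n) (λ S → cong 𝟙 (e S))

countℚ-mono-≤ : ∀ {n} {P Q : SetSys n} → (∀ S → T (P S) → T (Q S)) → countℚ P ≤ countℚ Q
countℚ-mono-≤ {n} {P} {Q} h = sumL-mono-≤ (allSubsets n) (λ S → 𝟙-mono-≤ (P S) (Q S) (h S))

countℚ-empty : ∀ {n} {P : SetSys n} → (∀ S → P S ≡ false) → countℚ P ≡ 0ℚ
countℚ-empty {n} e = trans (countℚ-cong e) (sumL-0 (allSubsets n))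

degℚ : ∀ {n} → SetSys n → Fin n → ℚ
degℚ H v = countℚ (λ e → H e ∧ lookup e v)

T-lookup⇒∈ : ∀ {n} {v : Fin n} {e} → T (lookup e v) → v ∈ e
T-lookup⇒∈ {v = v} {e} t = Vec.lookup⇒[]= v e (to Bool.T-≡ t)

∈⇒T-lookup : ∀ {n} {v : Fin n} {e} → v ∈ e → T (lookup e v)
∈⇒T-lookup v∈e = from Bool.T-≡ (Vec.[]=⇒lookup v∈e)

lookup-∁ : ∀ {n} (C : Subset n) v → lookup (∁ C) v ≡ not (lookup C v)
lookup-∁ C v = Vec.lookup-map v not C

⁅v⁆⊆ᵇe≡lookup : ∀ {n} (v : Fin n) e → (⁅ v ⁆ ⊆ᵇ e) ≡ lookup e v
⁅v⁆⊆ᵇe≡lookup zero (true ∷ e) = ⊥⊆ᵇ e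
  where
  ⊥⊆ᵇ : ∀ {m} (e : Subset m) → (⊥ ⊆ᵇ e) ≡ true
  ⊥⊆ᵇ [] = refl
  ⊥⊆ᵇ (_ ∷ e) = ⊥⊆ᵇ e
⁅v⁆⊆ᵇe≡lookup zero (false ∷ e) = refl
⁅v⁆⊆ᵇe≡lookup (suc v) (_ ∷ e) = ⁅v⁆⊆ᵇe≡lookup v e

⊆ᵇ⇒⊆ : ∀ {n} (e D : Subset n) → T (e ⊆ᵇ D) → ∀ x → T (lookup e x) → T (lookup D x)
⊆ᵇ⇒⊆ (true ∷ e) (true ∷ D) s zero t = tt
⊆ᵇ⇒⊆ (true ∷ e) (true ∷ D) s (suc x) t = ⊆ᵇ⇒⊆ e D s x t
⊆ᵇ⇒⊆ (false ∷ e) (d ∷ D) s (suc x) t = ⊆ᵇ⇒⊆ e D s x t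

⊆⇒⊆ᵇ : ∀ {n} (e D : Subset n) → (∀ x → T (lookup e x) → T (lookup D x)) → T (e ⊆ᵇ D)
⊆⇒⊆ᵇ [] [] h = tt
⊆⇒⊆ᵇ (true ∷ e) (true ∷ D) h = ⊆⇒⊆ᵇ e D (λ x → h (suc x))
⊆⇒⊆ᵇ (true ∷ e) (false ∷ D) h = h zero tt
⊆⇒⊆ᵇ (false ∷ e) (d ∷ D) h = ⊆⇒⊆ᵇ e D (λ x → h (suc x))

∣e∣≡sumV-𝟙 : ∀ {n} (e : Subset n) → ℕ→ℚ ∣ e ∣ ≡ sumV (λ v → 𝟙 (lookup e v))
∣e∣≡sumV-𝟙 [] = refl
∣e∣≡sumV-𝟙 (true ∷ e) = trans (ℕ→ℚ-suc ∣ e ∣) (cong (1ℚ +_) (∣e∣≡sumV-𝟙 e))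
∣e∣≡sumV-𝟙 (false ∷ e) = trans (∣e∣≡sumV-𝟙 e) (sym (ℚ.+-identityˡ _))

∣∁C∣+∣C∣≡n : ∀ {n} (C : Subset n) → ℕ→ℚ ∣ ∁ C ∣ + ℕ→ℚ ∣ C ∣ ≡ ℕ→ℚ n
∣∁C∣+∣C∣≡n {n} C = begin
  ℕ→ℚ ∣ ∁ C ∣ + ℕ→ℚ ∣ C ∣
    ≡⟨ cong₂ _+_ (∣e∣≡sumV-𝟙 (∁ C)) (∣e∣≡sumV-𝟙 C) ⟩
  sumV (λ v → 𝟙 (lookup (∁ C) v)) + sumV (λ v → 𝟙 (lookup C v))
    ≡⟨ sym (sumV-+ (λ v → 𝟙 (lookup (∁ C) v)) (λ v → 𝟙 (lookup C v))) ⟩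
  sumV (λ v → 𝟙 (lookup (∁ C) v) + 𝟙 (lookup C v))
    ≡⟨ sumV-cong (λ v → trans (cong (λ b → 𝟙 b + 𝟙 (lookup C v)) (lookup-∁ C v)) (𝟙-not+𝟙 (lookup C v))) ⟩
  sumV {n} (λ _ → 1ℚ)
    ≡⟨ sumV-1 {n} ⟩
  ℕ→ℚ n ∎
  where open ≡-Reasoning

size-mono : ∀ {n} (a b : Subset n) → (∀ x → T (lookup a x) → T (lookup b x)) → ∣ a ∣ ≤ℕ ∣ b ∣
size-mono a b a⊆b = Subset.p⊆q⇒∣p∣≤∣q∣ {p = a} {q = b} (λ {x} x∈a → T-lookup⇒∈ (a⊆b x (∈⇒T-lookup x∈a)))

size-strict : ∀ {n} (a b : Subset n) → (∀ x → T (lookup a x) → T (lookup b x)) → a ≢ b → ℕ.suc ∣ a ∣ ≤ℕ ∣ b ∣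
size-strict [] [] _ a≢b = ⊥-elim (a≢b refl)
size-strict (true ∷ a) (true ∷ b) h a≢b = ℕ.s≤s (size-strict a b (λ x → h (suc x)) (λ e → a≢b (cong (true ∷_) e)))
size-strict (true ∷ a) (false ∷ b) h _ = ⊥-elim (h zero tt)
size-strict (false ∷ a) (true ∷ b) h _ = ℕ.s≤s (size-mono a b (λ x → h (suc x)))
size-strict (false ∷ a) (false ∷ b) h a≢b = size-strict a b (λ x → h (suc x)) (λ e → a≢b (cong (false ∷_) e))

size-nonEmpty : ∀ {n} (a : Subset n) x → T (lookup a x) → 1 ≤ℕ ∣ a ∣
size-nonEmpty (true ∷ a) x t = ℕ.s≤s ℕ.z≤n
size-nonEmpty (false ∷ a) (suc x) t = size-nonEmpty a x t

0-set≡⊥ : ∀ {n} (e : Subset n) → (0 ≡ᵇ ∣ e ∣) ≡ true → e ≡ ⊥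
0-set≡⊥ [] _ = refl
0-set≡⊥ (false ∷ e) p = cong (false ∷_) (0-set≡⊥ e p)

0-set∌ : ∀ {n} (e : Subset n) v → (0 ≡ᵇ ∣ e ∣) ∧ lookup e v ≡ false
0-set∌ (true ∷ e) v = refl
0-set∌ (false ∷ e) zero = Bool.∧-zeroʳ _
0-set∌ (false ∷ e) (suc v) = 0-set∌ e v

1-set≡singleton : ∀ {n} (e : Subset n) → (1 ≡ᵇ ∣ e ∣) ≡ true → Σ (Fin n) λ w → e ≡ ⁅ w ⁆
1-set≡singleton (true ∷ e) p = zero , cong (true ∷_) (0-set≡⊥ e p)
1-set≡singleton (false ∷ e) p with 1-set≡singleton e p
... | w , e≡⁅w⁆ = suc w , cong (false ∷_) e≡⁅w⁆

lookup-⁅⁆ : ∀ {n} (w v : Fin n) → T (lookup ⁅ w ⁆ v) → v ≡ w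
lookup-⁅⁆ w v t = Subset.x∈⁅y⁆⇒x≡y w (T-lookup⇒∈ t)

2-set∋v≡pair : ∀ {n} (e : Subset n) (v : Fin n) → (2 ≡ᵇ ∣ e ∣) ≡ true → T (lookup e v) →
  Σ (Fin n) λ w → e ≡ ⁅ v ⁆ ∪ ⁅ w ⁆
2-set∋v≡pair (true ∷ e) zero p _ with 1-set≡singleton e p
... | w , e≡⁅w⁆ = suc w , cong (true ∷_) (trans e≡⁅w⁆ (sym (Subset.∪-identityˡ ⁅ w ⁆)))
2-set∋v≡pair (true ∷ e) (suc v) p t with 1-set≡singleton e p
... | w , e≡⁅w⁆ = zero , cong (true ∷_) (trans e≡⁅w⁆
  (trans (cong ⁅_⁆ (sym (lookup-⁅⁆ w v (subst (λ z → T (lookup z v)) e≡⁅w⁆ t))))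
         (sym (Subset.∪-identityʳ ⁅ v ⁆))))
2-set∋v≡pair (false ∷ e) (suc v) p t with 2-set∋v≡pair e v p t
... | w , e≡vw = suc w , cong (false ∷_) e≡vw

lookup-pair : ∀ {n} (v w x : Fin n) → T (lookup (⁅ v ⁆ ∪ ⁅ w ⁆) x) → (x ≡ v) ⊎ (x ≡ w)
lookup-pair v w x t with Subset.x∈p∪q⁻ ⁅ v ⁆ ⁅ w ⁆ (T-lookup⇒∈ t)
... | inj₁ x∈⁅v⁆ = inj₁ (Subset.x∈⁅y⁆⇒x≡y v x∈⁅v⁆)
... | inj₂ x∈⁅w⁆ = inj₂ (Subset.x∈⁅y⁆⇒x≡y w x∈⁅w⁆)

countℚ-0-sets⊆ : ∀ {n} (D : Subset n) → countℚ (λ e → (0 ≡ᵇ ∣ e ∣) ∧ (e ⊆ᵇ D)) ≡ 1ℚ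
countℚ-0-sets⊆ [] = refl
countℚ-0-sets⊆ {ℕ.suc n} (d ∷ D) = trans (countℚ-split (λ e → (0 ≡ᵇ ∣ e ∣) ∧ (e ⊆ᵇ (d ∷ D))))
  (trans (cong₂ _+_ (sumL-0 (allSubsets n)) (countℚ-0-sets⊆ D)) (ℚ.+-identityˡ 1ℚ))

countℚ-1-sets⊆ : ∀ {n} (D : Subset n) → countℚ (λ e → (1 ≡ᵇ ∣ e ∣) ∧ (e ⊆ᵇ D)) ≡ ℕ→ℚ ∣ D ∣
countℚ-1-sets⊆ [] = refl
countℚ-1-sets⊆ (true ∷ D) = trans (countℚ-split (λ e → (1 ≡ᵇ ∣ e ∣) ∧ (e ⊆ᵇ (true ∷ D))))
  (trans (cong₂ _+_ (countℚ-0-sets⊆ D) (countℚ-1-sets⊆ D)) (sym (ℕ→ℚ-suc ∣ D ∣)))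
countℚ-1-sets⊆ {ℕ.suc n} (false ∷ D) = trans (countℚ-split (λ e → (1 ≡ᵇ ∣ e ∣) ∧ (e ⊆ᵇ (false ∷ D))))
  (trans (cong₂ _+_ (countℚ-empty {n} (λ e → Bool.∧-zeroʳ (0 ≡ᵇ ∣ e ∣))) (countℚ-1-sets⊆ D))
         (ℚ.+-identityˡ (ℕ→ℚ ∣ D ∣)))

countℚ-1-sets∋⊆ : ∀ {n} (D : Subset n) v → T (lookup D v) →
  countℚ (λ e → (1 ≡ᵇ ∣ e ∣) ∧ lookup e v ∧ (e ⊆ᵇ D)) ≡ 1ℚ
countℚ-1-sets∋⊆ {ℕ.suc n} (true ∷ D) zero _ =
  trans (countℚ-split (λ e → (1 ≡ᵇ ∣ e ∣) ∧ lookup e zero ∧ (e ⊆ᵇ (true ∷ D))))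
  (trans (cong₂ _+_ (countℚ-0-sets⊆ D) (countℚ-empty {n} (λ e → Bool.∧-zeroʳ (1 ≡ᵇ ∣ e ∣)))) (ℚ.+-identityʳ 1ℚ))
countℚ-1-sets∋⊆ {ℕ.suc n} (d ∷ D) (suc v) t =
  trans (countℚ-split (λ e → (1 ≡ᵇ ∣ e ∣) ∧ lookup e (suc v) ∧ (e ⊆ᵇ (d ∷ D))))
  (trans (cong₂ _+_ (countℚ-empty {n} no-0-set∋v) (countℚ-1-sets∋⊆ D v t)) (ℚ.+-identityˡ 1ℚ))
  where
  no-0-set∋v : ∀ e → (0 ≡ᵇ ∣ e ∣) ∧ lookup e v ∧ ((true ∷ e) ⊆ᵇ (d ∷ D)) ≡ false
  no-0-set∋v e rewrite sym (Bool.∧-assoc (0 ≡ᵇ ∣ e ∣) (lookup e v) ((true ∷ e) ⊆ᵇ (d ∷ D))) | 0-set∌ e v = refl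

countℚ-2-sets∋⊆ : ∀ {n} (D : Subset n) v → T (lookup D v) →
  countℚ (λ e → (2 ≡ᵇ ∣ e ∣) ∧ lookup e v ∧ (e ⊆ᵇ D)) + 1ℚ ≡ ℕ→ℚ ∣ D ∣
countℚ-2-sets∋⊆ {ℕ.suc n} (true ∷ D) zero _ = begin
  countℚ (λ e → (2 ≡ᵇ ∣ e ∣) ∧ lookup e zero ∧ (e ⊆ᵇ (true ∷ D))) + 1ℚ
    ≡⟨ cong (_+ 1ℚ) (countℚ-split (λ e → (2 ≡ᵇ ∣ e ∣) ∧ lookup e zero ∧ (e ⊆ᵇ (true ∷ D)))) ⟩
  (countℚ (λ e → (1 ≡ᵇ ∣ e ∣) ∧ (e ⊆ᵇ D)) + countℚ {n} (λ e → (2 ≡ᵇ ∣ e ∣) ∧ false)) + 1ℚ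
    ≡⟨ cong₂ (λ x y → (x + y) + 1ℚ) (countℚ-1-sets⊆ D)
             (countℚ-empty {n} (λ e → Bool.∧-zeroʳ (2 ≡ᵇ ∣ e ∣))) ⟩
  (ℕ→ℚ ∣ D ∣ + 0ℚ) + 1ℚ
    ≡⟨ solve 1 (λ x → (x :+ con 0ℚ) :+ con 1ℚ := con 1ℚ :+ x) refl (ℕ→ℚ ∣ D ∣) ⟩
  1ℚ + ℕ→ℚ ∣ D ∣
    ≡⟨ sym (ℕ→ℚ-suc ∣ D ∣) ⟩
  ℕ→ℚ ∣ true ∷ D ∣ ∎
  where open ≡-Reasoning
countℚ-2-sets∋⊆ (true ∷ D) (suc v) t = begin
  countℚ (λ e → (2 ≡ᵇ ∣ e ∣) ∧ lookup e (suc v) ∧ (e ⊆ᵇ (true ∷ D))) + 1ℚ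
    ≡⟨ cong (_+ 1ℚ) (countℚ-split (λ e → (2 ≡ᵇ ∣ e ∣) ∧ lookup e (suc v) ∧ (e ⊆ᵇ (true ∷ D)))) ⟩
  (countℚ (λ e → (1 ≡ᵇ ∣ e ∣) ∧ lookup e v ∧ (e ⊆ᵇ D)) + E) + 1ℚ
    ≡⟨ cong (λ x → (x + E) + 1ℚ) (countℚ-1-sets∋⊆ D v t) ⟩
  (1ℚ + E) + 1ℚ
    ≡⟨ ℚ.+-assoc 1ℚ E 1ℚ ⟩
  1ℚ + (E + 1ℚ)
    ≡⟨ cong (1ℚ +_) (countℚ-2-sets∋⊆ D v t) ⟩
  1ℚ + ℕ→ℚ ∣ D ∣
    ≡⟨ sym (ℕ→ℚ-suc ∣ D ∣) ⟩
  ℕ→ℚ ∣ true ∷ D ∣ ∎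
  where
  open ≡-Reasoning
  E = countℚ (λ e → (2 ≡ᵇ ∣ e ∣) ∧ lookup e v ∧ (e ⊆ᵇ D))
countℚ-2-sets∋⊆ {ℕ.suc n} (false ∷ D) (suc v) t = begin
  countℚ (λ e → (2 ≡ᵇ ∣ e ∣) ∧ lookup e (suc v) ∧ (e ⊆ᵇ (false ∷ D))) + 1ℚ
    ≡⟨ cong (_+ 1ℚ) (countℚ-split (λ e → (2 ≡ᵇ ∣ e ∣) ∧ lookup e (suc v) ∧ (e ⊆ᵇ (false ∷ D)))) ⟩
  (countℚ (λ e → (1 ≡ᵇ ∣ e ∣) ∧ lookup e v ∧ false) + E) + 1ℚ
    ≡⟨ cong (λ x → (x + E) + 1ℚ) (countℚ-empty {n} (λ e →
         trans (cong ((1 ≡ᵇ ∣ e ∣) ∧_) (Bool.∧-zeroʳ (lookup e v))) (Bool.∧-zeroʳ (1 ≡ᵇ ∣ e ∣)))) ⟩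
  (0ℚ + E) + 1ℚ
    ≡⟨ cong (_+ 1ℚ) (ℚ.+-identityˡ E) ⟩
  E + 1ℚ
    ≡⟨ countℚ-2-sets∋⊆ D v t ⟩
  ℕ→ℚ ∣ false ∷ D ∣ ∎
  where
  open ≡-Reasoning
  E = countℚ (λ e → (2 ≡ᵇ ∣ e ∣) ∧ lookup e v ∧ (e ⊆ᵇ D))

-- Link graphs

==≡≡ᵇ : ∀ a b → (a == b) ≡ (a ≡ᵇ b)
==≡≡ᵇ a b = trans (⌊⌋-map′ _ _ _) (isYes≗does _)

disjointᵇ : ∀ {n} → Subset n → Subset n → Bool
disjointᵇ [] [] = true
disjointᵇ (a ∷ A) (b ∷ e) = not (a ∧ b) ∧ disjointᵇ A e

countℚ-⊇≡countℚ-disjoint-∪ : ∀ {n} (P : SetSys n) (A : Subset n) →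
  countℚ (λ X → P X ∧ (A ⊆ᵇ X)) ≡ countℚ (λ e → disjointᵇ A e ∧ P (A ∪ e))
countℚ-⊇≡countℚ-disjoint-∪ P [] = cong (λ b → 𝟙 b + 0ℚ) (Bool.∧-identityʳ (P []))
countℚ-⊇≡countℚ-disjoint-∪ {ℕ.suc n} P (true ∷ A) = begin
  countℚ (λ X → P X ∧ ((true ∷ A) ⊆ᵇ X))
    ≡⟨ countℚ-split (λ X → P X ∧ ((true ∷ A) ⊆ᵇ X)) ⟩
  countℚ (λ X → P (true ∷ X) ∧ (A ⊆ᵇ X)) + countℚ (λ X → P (false ∷ X) ∧ false)
    ≡⟨ cong₂ _+_ (countℚ-⊇≡countℚ-disjoint-∪ (λ X → P (true ∷ X)) A)
                 (countℚ-empty {n} (λ X → Bool.∧-zeroʳ (P (false ∷ X)))) ⟩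
  E + 0ℚ
    ≡⟨ trans (ℚ.+-identityʳ E) (sym (trans (cong (_+ E) (sumL-0 (allSubsets n))) (ℚ.+-identityˡ E))) ⟩
  countℚ {n} (λ _ → false) + E
    ≡⟨ sym (countℚ-split (λ e → disjointᵇ (true ∷ A) e ∧ P ((true ∷ A) ∪ e))) ⟩
  countℚ (λ e → disjointᵇ (true ∷ A) e ∧ P ((true ∷ A) ∪ e)) ∎
  where
  open ≡-Reasoning
  E = countℚ (λ e → disjointᵇ A e ∧ P (true ∷ (A ∪ e)))
countℚ-⊇≡countℚ-disjoint-∪ {ℕ.suc n} P (false ∷ A) = begin
  countℚ (λ X → P X ∧ ((false ∷ A) ⊆ᵇ X))
    ≡⟨ countℚ-split (λ X → P X ∧ ((false ∷ A) ⊆ᵇ X)) ⟩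
  countℚ (λ X → P (true ∷ X) ∧ (A ⊆ᵇ X)) + countℚ (λ X → P (false ∷ X) ∧ (A ⊆ᵇ X))
    ≡⟨ cong₂ _+_ (countℚ-⊇≡countℚ-disjoint-∪ (λ X → P (true ∷ X)) A)
                 (countℚ-⊇≡countℚ-disjoint-∪ (λ X → P (false ∷ X)) A) ⟩
  countℚ (λ e → disjointᵇ A e ∧ P (true ∷ (A ∪ e))) + countℚ (λ e → disjointᵇ A e ∧ P (false ∷ (A ∪ e)))
    ≡⟨ sym (countℚ-split (λ e → disjointᵇ (false ∷ A) e ∧ P ((false ∷ A) ∪ e))) ⟩
  countℚ (λ e → disjointᵇ (false ∷ A) e ∧ P ((false ∷ A) ∪ e)) ∎
  where open ≡-Reasoning

∣p∪q∣≤∣p∣+∣q∣ : ∀ {n} (p q : Subset n) → ∣ p ∪ q ∣ ≤ℕ ∣ p ∣ ℕ.+ ∣ q ∣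
∣p∪q∣≤∣p∣+∣q∣ [] [] = ℕ.z≤n
∣p∪q∣≤∣p∣+∣q∣ (true ∷ p) (true ∷ q) rewrite ℕ.+-suc ∣ p ∣ ∣ q ∣ = ℕ.s≤s (ℕ.m≤n⇒m≤1+n (∣p∪q∣≤∣p∣+∣q∣ p q))
∣p∪q∣≤∣p∣+∣q∣ (true ∷ p) (false ∷ q) = ℕ.s≤s (∣p∪q∣≤∣p∣+∣q∣ p q)
∣p∪q∣≤∣p∣+∣q∣ (false ∷ p) (true ∷ q) rewrite ℕ.+-suc ∣ p ∣ ∣ q ∣ = ℕ.s≤s (∣p∪q∣≤∣p∣+∣q∣ p q)
∣p∪q∣≤∣p∣+∣q∣ (false ∷ p) (false ∷ q) = ∣p∪q∣≤∣p∣+∣q∣ p q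

disjoint⇒∣p∪q∣≡∣p∣+∣q∣ : ∀ {n} (p q : Subset n) → T (disjointᵇ p q) →
  ∣ p ∪ q ∣ ≡ ∣ p ∣ ℕ.+ ∣ q ∣
disjoint⇒∣p∪q∣≡∣p∣+∣q∣ [] [] _ = refl
disjoint⇒∣p∪q∣≡∣p∣+∣q∣ (true ∷ p) (false ∷ q) d = cong ℕ.suc (disjoint⇒∣p∪q∣≡∣p∣+∣q∣ p q d)
disjoint⇒∣p∪q∣≡∣p∣+∣q∣ (false ∷ p) (true ∷ q) d rewrite ℕ.+-suc ∣ p ∣ ∣ q ∣ =
  cong ℕ.suc (disjoint⇒∣p∪q∣≡∣p∣+∣q∣ p q d)
disjoint⇒∣p∪q∣≡∣p∣+∣q∣ (false ∷ p) (false ∷ q) d = disjoint⇒∣p∪q∣≡∣p∣+∣q∣ p q d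

overlap⇒∣p∪q∣<∣p∣+∣q∣ : ∀ {n} (p q : Subset n) → disjointᵇ p q ≡ false →
  ℕ.suc ∣ p ∪ q ∣ ≤ℕ ∣ p ∣ ℕ.+ ∣ q ∣
overlap⇒∣p∪q∣<∣p∣+∣q∣ [] [] ()
overlap⇒∣p∪q∣<∣p∣+∣q∣ (true ∷ p) (true ∷ q) _ rewrite ℕ.+-suc ∣ p ∣ ∣ q ∣ = ℕ.s≤s (ℕ.s≤s (∣p∪q∣≤∣p∣+∣q∣ p q))
overlap⇒∣p∪q∣<∣p∣+∣q∣ (true ∷ p) (false ∷ q) o = ℕ.s≤s (overlap⇒∣p∪q∣<∣p∣+∣q∣ p q o)
overlap⇒∣p∪q∣<∣p∣+∣q∣ (false ∷ p) (true ∷ q) o rewrite ℕ.+-suc ∣ p ∣ ∣ q ∣ = ℕ.s≤s (overlap⇒∣p∪q∣<∣p∣+∣q∣ p q o)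
overlap⇒∣p∪q∣<∣p∣+∣q∣ (false ∷ p) (false ∷ q) o = overlap⇒∣p∪q∣<∣p∣+∣q∣ p q o

disjoint∧edge≡link : ∀ {n k} (G : KGraph n k) (A : Subset n) → ∣ A ∣ ℕ.+ 2 ≡ k →
  ∀ e → disjointᵇ A e ∧ edge G (A ∪ e) ≡ link G A e
disjoint∧edge≡link G A ∣A∣+2≡k e rewrite ==≡≡ᵇ 2 ∣ e ∣
  with edge G (A ∪ e) in isEdge | disjointᵇ A e in disj | 2 ≡ᵇ ∣ e ∣ in isPair
... | false | d | p = trans (Bool.∧-zeroʳ d) (sym (Bool.∧-zeroʳ p))
... | true | true | true = refl
... | true | false | false = refl
... | true | true | false = ⊥-elim (true≢false (subst (λ m → (2 ≡ᵇ m) ≡ false) ∣e∣≡2 isPair))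
  where
  ∣e∣≡2 : ∣ e ∣ ≡ 2
  ∣e∣≡2 = ℕ.+-cancelˡ-≡ ∣ A ∣ ∣ e ∣ 2 (trans (sym (disjoint⇒∣p∪q∣≡∣p∣+∣q∣ A e (from Bool.T-≡ disj)))
    (trans (uniform G (A ∪ e) (from Bool.T-≡ isEdge)) (sym ∣A∣+2≡k)))
  true≢false : true ≢ false
  true≢false ()
... | true | false | true = ⊥-elim (ℕ.<-irrefl refl (ℕ.≤-trans
  (subst (λ m → ℕ.suc m ≤ℕ ∣ A ∣ ℕ.+ ∣ e ∣) (uniform G (A ∪ e) (from Bool.T-≡ isEdge))
         (overlap⇒∣p∪q∣<∣p∣+∣q∣ A e disj))
  (ℕ.≤-reflexive (trans (cong (∣ A ∣ ℕ.+_) (sym (ℕ.≡ᵇ⇒≡ 2 ∣ e ∣ (from Bool.T-≡ isPair)))) ∣A∣+2≡k))))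

deg≡countℚ-link : ∀ {n k} (G : KGraph n k) (A : Subset n) → ∣ A ∣ ℕ.+ 2 ≡ k →
  ℕ→ℚ (deg (edge G) A) ≡ countℚ (link G A)
deg≡countℚ-link G A ∣A∣+2≡k = trans (count≡countℚ (λ X → edge G X ∧ (A ⊆ᵇ X)))
  (trans (countℚ-⊇≡countℚ-disjoint-∪ (edge G) A) (countℚ-cong (disjoint∧edge≡link G A ∣A∣+2≡k)))

-- Components and degrees in 2-graphs

Reach-snoc : ∀ {n} {L : SetSys n} {u x w} → Reach L u x → T (L (⁅ x ⁆ ∪ ⁅ w ⁆)) → Reach L u w
Reach-snoc here xw = step xw here
Reach-snoc (step uv r) xw = step uv (Reach-snoc r xw)

IsComponent-closed : ∀ {n} (L : SetSys n) (C : Subset n) → IsComponent L C →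
  ∀ x y → T (lookup C x) → T (L (⁅ x ⁆ ∪ ⁅ y ⁆)) → T (lookup C y)
IsComponent-closed L C (_ , _ , C≡reach) x y x∈C xy =
  ∈⇒T-lookup (from (C≡reach y) (Reach-snoc (to (C≡reach x) (T-lookup⇒∈ x∈C)) xy))

-- The component of u₀ is the limit of growing ⁅ u₀ ⁆ by all neighbours; every growth step that changes the
-- set enlarges it, so after n steps it is stable.
module ComponentOf {n} (L : SetSys n) (u₀ : Fin n) where

  adjacent : Fin n → Fin n → Bool
  adjacent u w = L (⁅ u ⁆ ∪ ⁅ w ⁆)

  grow : Subset n → Subset n
  grow R = tabulate (λ w → lookup R w ∨ isYes (any? (λ u → Bool.T? (lookup R u ∧ adjacent u w))))

  lookup-grow : ∀ R w →
    lookup (grow R) w ≡ (lookup R w ∨ isYes (any? (λ u → Bool.T? (lookup R u ∧ adjacent u w))))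
  lookup-grow R w = Vec.lookup∘tabulate _ w

  ⊆-grow : ∀ R x → T (lookup R x) → T (lookup (grow R) x)
  ⊆-grow R x x∈R = subst T (sym (lookup-grow R x)) (from Bool.T-∨ (inj₁ x∈R))

  grow-neighbour : ∀ R x w → T (lookup R x) → T (adjacent x w) → T (lookup (grow R) w)
  grow-neighbour R x w x∈R xw = subst T (sym (lookup-grow R w)) (from (Bool.T-∨ {lookup R w})
    (inj₂ (fromWitness {a? = any? (λ u → Bool.T? (lookup R u ∧ adjacent u w))} (x , from Bool.T-∧ (x∈R , xw)))))

  stage : ℕ → Subset n
  stage ℕ.zero = ⁅ u₀ ⁆
  stage (ℕ.suc i) = grow (stage i)

  u₀∈stage : ∀ i → T (lookup (stage i) u₀)
  u₀∈stage ℕ.zero = ∈⇒T-lookup (Subset.x∈⁅x⁆ u₀)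
  u₀∈stage (ℕ.suc i) = ⊆-grow (stage i) u₀ (u₀∈stage i)

  stage-reachable : ∀ i w → T (lookup (stage i) w) → Reach L u₀ w
  stage-reachable ℕ.zero w w∈ = subst (Reach L u₀) (sym (lookup-⁅⁆ u₀ w w∈)) here
  stage-reachable (ℕ.suc i) w w∈ with to Bool.T-∨ (subst T (lookup-grow (stage i) w) w∈)
  ... | inj₁ w∈stage = stage-reachable i w w∈stage
  ... | inj₂ hasNeighbour with toWitness hasNeighbour
  ...   | u , u∈∧uw = let (u∈ , uw) = to Bool.T-∧ u∈∧uw in Reach-snoc (stage-reachable i u u∈) uw

  stable-or-growing : ∀ i → (grow (stage i) ≡ stage i) ⊎ (ℕ.suc i ≤ℕ ∣ stage i ∣)
  stable-or-growing ℕ.zero = inj₂ (size-nonEmpty ⁅ u₀ ⁆ u₀ (u₀∈stage 0))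
  stable-or-growing (ℕ.suc i) with stable-or-growing i
  ... | inj₁ stable = inj₁ (cong grow stable)
  ... | inj₂ growing with Vec.≡-dec Bool._≟_ (grow (stage (ℕ.suc i))) (stage (ℕ.suc i))
  ...   | yes stable = inj₁ stable
  ...   | no unstable = inj₂ (ℕ.≤-trans (ℕ.s≤s growing)
          (size-strict (stage i) (stage (ℕ.suc i)) (⊆-grow (stage i)) (λ e → unstable (sym (cong grow e)))))

  component : Subset n
  component = stage n

  grow-component : grow component ≡ component
  grow-component with stable-or-growing n
  ... | inj₁ stable = stable
  ... | inj₂ growing = ⊥-elim (ℕ.<-irrefl refl (ℕ.≤-trans growing (Subset.∣p∣≤n component)))

  u₀∈component : T (lookup component u₀)
  u₀∈component = u₀∈stage n

  component-closed : ∀ x y → T (lookup component x) → T (adjacent x y) → T (lookup component y)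
  component-closed x y x∈ xy =
    subst T (cong (λ R → lookup R y) grow-component) (grow-neighbour component x y x∈ xy)

  reachable⇒∈component : ∀ {x w} → T (lookup component x) → Reach L x w → T (lookup component w)
  reachable⇒∈component x∈ here = x∈
  reachable⇒∈component {x} x∈ (step {v = v} xv r) = reachable⇒∈component (component-closed x v x∈ xv) r

  component-isComponent : IsComponent L component
  component-isComponent = u₀ , T-lookup⇒∈ u₀∈component , λ v →
    mk⇔ (λ v∈ → stage-reachable n v (∈⇒T-lookup v∈)) (λ r → T-lookup⇒∈ (reachable⇒∈component u₀∈component r))

Is2Graph : ∀ {n} → SetSys n → Set
Is2Graph L = ∀ e → T (L e) → (2 ≡ᵇ ∣ e ∣) ≡ true

handshake : ∀ {n} (H : SetSys n) → Is2Graph H → sumV (degℚ H) ≡ 2ℚ * countℚ H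
handshake {n} H isGraph = begin
  sumV (λ v → sumS (λ e → 𝟙 (H e ∧ lookup e v)))
    ≡⟨ sym (sumL-sumV-comm (allSubsets n) (λ v e → 𝟙 (H e ∧ lookup e v))) ⟩
  sumS (λ e → sumV (λ v → 𝟙 (H e ∧ lookup e v)))
    ≡⟨ sumL-cong (allSubsets n) size-if-edge ⟩
  sumS (λ e → 2ℚ * 𝟙 (H e))
    ≡⟨ sumL-*ˡ (allSubsets n) 2ℚ (λ e → 𝟙 (H e)) ⟩
  2ℚ * countℚ H ∎
  where
  open ≡-Reasoning
  size-if-edge : ∀ e → sumV (λ v → 𝟙 (H e ∧ lookup e v)) ≡ 2ℚ * 𝟙 (H e)
  size-if-edge e with H e in isEdge
  ... | true = trans (sym (∣e∣≡sumV-𝟙 e))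
    (cong ℕ→ℚ (sym (ℕ.≡ᵇ⇒≡ 2 ∣ e ∣ (from Bool.T-≡ (isGraph e (from Bool.T-≡ isEdge))))))
  ... | false = trans (sumV-0 {n}) (sym (ℚ.*-zeroʳ 2ℚ))

module _ {n} (L : SetSys n) (isGraph : Is2Graph L) where

  edge∋v⊆ : ∀ (D : Subset n) v e → (∀ w → T (L (⁅ v ⁆ ∪ ⁅ w ⁆)) → T (lookup D w)) → T (lookup D v) →
    T (L e) → T (lookup e v) → T (e ⊆ᵇ D)
  edge∋v⊆ D v e N[v]⊆D v∈D e∈L v∈e with 2-set∋v≡pair e v (isGraph e e∈L) v∈e
  ... | w , e≡vw = ⊆⇒⊆ᵇ e D λ x x∈e → in-D (lookup-pair v w x (subst (λ z → T (lookup z x)) e≡vw x∈e))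
    where
    in-D : ∀ {x} → (x ≡ v) ⊎ (x ≡ w) → T (lookup D x)
    in-D (inj₁ refl) = v∈D
    in-D (inj₂ refl) = N[v]⊆D w (subst (λ z → T (L z)) e≡vw e∈L)

  degℚ+1≤∣D∣ : ∀ (D : Subset n) v → (∀ w → T (L (⁅ v ⁆ ∪ ⁅ w ⁆)) → T (lookup D w)) → T (lookup D v) →
    degℚ L v + 1ℚ ≤ ℕ→ℚ ∣ D ∣
  degℚ+1≤∣D∣ D v N[v]⊆D v∈D = subst (degℚ L v + 1ℚ ≤_) (countℚ-2-sets∋⊆ D v v∈D)
    (ℚ.+-monoˡ-≤ 1ℚ (countℚ-mono-≤ λ e e∈L∧v∈e → let (e∈L , v∈e) = to Bool.T-∧ e∈L∧v∈e in
      from Bool.T-∧ (from Bool.T-≡ (isGraph e e∈L) , from Bool.T-∧ (v∈e , edge∋v⊆ D v e N[v]⊆D v∈D e∈L v∈e))))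

module LargestComponent {n} (L : SetSys n) (isGraph : Is2Graph L) (C : Subset n) (largest : IsLargestComponent L C) where

  M K : ℚ
  M = ℕ→ℚ ∣ C ∣
  K = ℕ→ℚ ∣ ∁ C ∣

  L[C] : SetSys n
  L[C] = induced L C

  L[C]-is2Graph : Is2Graph L[C]
  L[C]-is2Graph e e∈L[C] = isGraph e (proj₁ (to Bool.T-∧ e∈L[C]))

  C-closed : ∀ x y → T (lookup C x) → T (L (⁅ x ⁆ ∪ ⁅ y ⁆)) → T (lookup C y)
  C-closed = IsComponent-closed L C (proj₁ largest)

  ∉C⇒∈∁C : ∀ x → lookup C x ≡ false → T (lookup (∁ C) x)
  ∉C⇒∈∁C x x∉C = subst T (sym (trans (lookup-∁ C x) (cong not x∉C))) tt

  1≤M : 1ℚ ≤ M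
  1≤M with proj₁ largest
  ... | u , u∈C , _ = ℕ→ℚ-mono-≤ (size-nonEmpty C u (∈⇒T-lookup u∈C))

  degℚ+1≤M : ∀ v → degℚ L v + 1ℚ ≤ M
  degℚ+1≤M v = ℚ.≤-trans
    (degℚ+1≤∣D∣ L isGraph component v (λ w → component-closed v w u₀∈component) u₀∈component)
    (ℕ→ℚ-mono-≤ (proj₂ largest component component-isComponent))
    where open ComponentOf L v

  degℚ+1≤K : ∀ v → lookup C v ≡ false → degℚ L v + 1ℚ ≤ K
  degℚ+1≤K v v∉C = degℚ+1≤∣D∣ L isGraph (∁ C) v N[v]⊆∁C (∉C⇒∈∁C v v∉C)
    where
    N[v]⊆∁C : ∀ w → T (L (⁅ v ⁆ ∪ ⁅ w ⁆)) → T (lookup (∁ C) w)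
    N[v]⊆∁C w vw with lookup C w in w∈C
    ... | false = ∉C⇒∈∁C w w∈C
    ... | true = ⊥-elim (subst T v∉C (C-closed w v (from Bool.T-≡ w∈C)
                   (subst (λ z → T (L z)) (Subset.∪-comm ⁅ v ⁆ ⁅ w ⁆) vw)))

  degℚ-L[C]-inside : ∀ v → T (lookup C v) → degℚ L[C] v ≡ degℚ L v
  degℚ-L[C]-inside v v∈C = countℚ-cong edge∋v⇒⊆C
    where
    edge∋v⇒⊆C : ∀ e → (L e ∧ (e ⊆ᵇ C)) ∧ lookup e v ≡ L e ∧ lookup e v
    edge∋v⇒⊆C e with L e in e∈L | lookup e v in v∈e
    ... | false | _ = refl
    ... | true | false = Bool.∧-zeroʳ _
    ... | true | true = trans (Bool.∧-identityʳ _) (to Bool.T-≡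
          (edge∋v⊆ L isGraph C v e (λ w → C-closed v w v∈C) v∈C (from Bool.T-≡ e∈L) (from Bool.T-≡ v∈e)))

  degℚ-L[C]-outside : ∀ v → lookup C v ≡ false → degℚ L[C] v ≡ 0ℚ
  degℚ-L[C]-outside v v∉C = countℚ-empty {n} no-edge
    where
    no-edge : ∀ e → L[C] e ∧ lookup e v ≡ false
    no-edge e with L[C] e ∧ lookup e v in e∋v
    ... | false = refl
    ... | true = let (e∈L[C] , v∈e) = to Bool.T-∧ (from Bool.T-≡ e∋v) in
      ⊥-elim (subst T v∉C (⊆ᵇ⇒⊆ e C (proj₂ (to Bool.T-∧ e∈L[C])) v v∈e))

  degℚ-L[C]≤M-1 : ∀ v → degℚ L[C] v ≤ M - 1ℚ
  degℚ-L[C]≤M-1 v with lookup C v in v∈C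
  ... | true = subst (_≤ M - 1ℚ) (sym (degℚ-L[C]-inside v (from Bool.T-≡ v∈C)))
                 (p+1≤q⇒p≤q-1 _ _ (degℚ+1≤M v))
  ... | false = subst (_≤ M - 1ℚ) (sym (degℚ-L[C]-outside v v∈C)) (p≤q⇒0≤q-p 1ℚ M 1≤M)

  2e[C]≤n[M-1] : 2ℚ * countℚ L[C] ≤ ℕ→ℚ n * (M - 1ℚ)
  2e[C]≤n[M-1] = subst₂ _≤_ (handshake L[C] L[C]-is2Graph)
    (trans (sumV-const {n} (M - 1ℚ)) (ℚ.*-comm (M - 1ℚ) (ℕ→ℚ n)))
    (sumV-mono-≤ degℚ-L[C]≤M-1)

  -- Outside C a vertex has fewer than min(K, M) neighbours, hence at most n/2.
  2degℚ≤2degℚ-L[C]+n·𝟙[∉C] : ∀ v → 2ℚ * degℚ L v ≤ 2ℚ * degℚ L[C] v + 𝟙 (not (lookup C v)) * ℕ→ℚ n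
  2degℚ≤2degℚ-L[C]+n·𝟙[∉C] v with lookup C v in v∈C
  ... | true = ℚ.≤-reflexive (trans (cong (2ℚ *_) (sym (degℚ-L[C]-inside v (from Bool.T-≡ v∈C))))
                 (sym (trans (cong (2ℚ * degℚ L[C] v +_) (ℚ.*-zeroˡ (ℕ→ℚ n))) (ℚ.+-identityʳ _))))
  ... | false = ≤-by-difference (2ℚ * degℚ L v) (2ℚ * degℚ L[C] v + 1ℚ * ℕ→ℚ n)
        ((M - (degℚ L v + 1ℚ)) + (K - (degℚ L v + 1ℚ)) + 2ℚ)
        (begin
          2ℚ * degℚ L[C] v + 1ℚ * ℕ→ℚ n - 2ℚ * degℚ L v
            ≡⟨ cong₂ (λ x y → 2ℚ * x + 1ℚ * y - 2ℚ * degℚ L v)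
                     (degℚ-L[C]-outside v v∈C) (sym (∣∁C∣+∣C∣≡n C)) ⟩
          2ℚ * 0ℚ + 1ℚ * (K + M) - 2ℚ * degℚ L v
            ≡⟨ solve 3 (λ d K M → con 2ℚ :* con 0ℚ :+ con 1ℚ :* (K :+ M) :- con 2ℚ :* d
                 := (M :- (d :+ con 1ℚ)) :+ (K :- (d :+ con 1ℚ)) :+ con 2ℚ) refl (degℚ L v) K M ⟩
          (M - (degℚ L v + 1ℚ)) + (K - (degℚ L v + 1ℚ)) + 2ℚ ∎)
        (0≤+ (0≤+ (p≤q⇒0≤q-p _ _ (degℚ+1≤M v)) (p≤q⇒0≤q-p _ _ (degℚ+1≤K v v∈C))) (ℕ→ℚ-nonNeg 2))
    where open ≡-Reasoning

  4e≤4e[C]+Kn : 4ℚ * countℚ L ≤ 4ℚ * countℚ L[C] + K * ℕ→ℚ n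
  4e≤4e[C]+Kn = subst₂ _≤_ lhs rhs (sumV-mono-≤ 2degℚ≤2degℚ-L[C]+n·𝟙[∉C])
    where
    lhs : sumV (λ v → 2ℚ * degℚ L v) ≡ 4ℚ * countℚ L
    lhs = trans (sumV-*ˡ 2ℚ (degℚ L)) (trans (cong (2ℚ *_) (handshake L isGraph))
      (sym (ℚ.*-assoc 2ℚ 2ℚ (countℚ L))))
    K≡sumV : sumV (λ v → 𝟙 (not (lookup C v))) ≡ K
    K≡sumV = sym (trans (∣e∣≡sumV-𝟙 (∁ C)) (sumV-cong (λ v → cong 𝟙 (lookup-∁ C v))))
    rhs : sumV (λ v → 2ℚ * degℚ L[C] v + 𝟙 (not (lookup C v)) * ℕ→ℚ n) ≡ 4ℚ * countℚ L[C] + K * ℕ→ℚ n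
    rhs = begin
      sumV (λ v → 2ℚ * degℚ L[C] v + 𝟙 (not (lookup C v)) * ℕ→ℚ n)
        ≡⟨ sumV-+ (λ v → 2ℚ * degℚ L[C] v) (λ v → 𝟙 (not (lookup C v)) * ℕ→ℚ n) ⟩
      sumV (λ v → 2ℚ * degℚ L[C] v) + sumV (λ v → 𝟙 (not (lookup C v)) * ℕ→ℚ n)
        ≡⟨ cong₂ _+_ (trans (sumV-*ˡ 2ℚ (degℚ L[C])) (cong (2ℚ *_) (handshake L[C] L[C]-is2Graph)))
             (trans (sumV-cong (λ v → ℚ.*-comm (𝟙 (not (lookup C v))) (ℕ→ℚ n)))
               (trans (sumV-*ˡ (ℕ→ℚ n) (λ v → 𝟙 (not (lookup C v)))) (cong (ℕ→ℚ n *_) K≡sumV))) ⟩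
      2ℚ * (2ℚ * countℚ L[C]) + ℕ→ℚ n * K
        ≡⟨ cong₂ _+_ (sym (ℚ.*-assoc 2ℚ 2ℚ (countℚ L[C]))) (ℚ.*-comm (ℕ→ℚ n) K) ⟩
      4ℚ * countℚ L[C] + K * ℕ→ℚ n ∎
      where open ≡-Reasoning

-- Weight products and fractional matchings

InUnitInterval : ∀ {n} → (Fin n → ℚ) → Set
InUnitInterval ω = ∀ v → 0ℚ ≤ ω v × ω v ≤ 1ℚ

prod : ∀ {n} → (Fin n → ℚ) → Subset n → ℚ
prod ω [] = 1ℚ
prod ω (b ∷ e) = (if b then ω zero else 1ℚ) * prod (λ i → ω (suc i)) e

deficit : ∀ {n} → (Fin n → ℚ) → Subset n → ℚ
deficit ω e = sumV (λ v → 𝟙 (lookup e v) * (1ℚ - ω v))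

factor∈[0,1] : ∀ {n} (ω : Fin (ℕ.suc n) → ℚ) → InUnitInterval ω →
  ∀ b → 0ℚ ≤ (if b then ω zero else 1ℚ) × (if b then ω zero else 1ℚ) ≤ 1ℚ
factor∈[0,1] ω ω∈[0,1] true = ω∈[0,1] zero
factor∈[0,1] ω ω∈[0,1] false = 0≤1 , ℚ.≤-refl

prod∈[0,1] : ∀ {n} (ω : Fin n → ℚ) → InUnitInterval ω → ∀ e → 0ℚ ≤ prod ω e × prod ω e ≤ 1ℚ
prod∈[0,1] ω _ [] = 0≤1 , ℚ.≤-refl
prod∈[0,1] ω ω∈[0,1] (b ∷ e)
  with factor∈[0,1] ω ω∈[0,1] b | prod∈[0,1] (λ i → ω (suc i)) (λ i → ω∈[0,1] (suc i)) e
... | (0≤x , x≤1) | (0≤p , p≤1) = 0≤* 0≤x 0≤p ,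
  ℚ.≤-trans (*-monoʳ-≤-0≤ 0≤p x≤1) (subst (_≤ 1ℚ) (sym (ℚ.*-identityˡ _)) p≤1)

prod≤ω : ∀ {n} (ω : Fin n → ℚ) → InUnitInterval ω → ∀ e v → T (lookup e v) → prod ω e ≤ ω v
prod≤ω ω ω∈[0,1] (true ∷ e) zero _ =
  ℚ.≤-trans (*-monoˡ-≤-0≤ (proj₁ (ω∈[0,1] zero))
              (proj₂ (prod∈[0,1] (λ i → ω (suc i)) (λ i → ω∈[0,1] (suc i)) e)))
            (ℚ.≤-reflexive (ℚ.*-identityʳ _))
prod≤ω ω ω∈[0,1] (b ∷ e) (suc v) v∈e =
  ℚ.≤-trans (*-monoʳ-≤-0≤ (proj₁ (prod∈[0,1] ω′ ω′∈[0,1] e)) (proj₂ (factor∈[0,1] ω ω∈[0,1] b)))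
            (subst (_≤ ω (suc v)) (sym (ℚ.*-identityˡ _)) (prod≤ω ω′ ω′∈[0,1] e v v∈e))
  where
  ω′ = λ i → ω (suc i)
  ω′∈[0,1] = λ i → ω∈[0,1] (suc i)

deficit-nonNeg : ∀ {n} (ω : Fin n → ℚ) → InUnitInterval ω → ∀ e → 0ℚ ≤ deficit ω e
deficit-nonNeg {n} ω ω∈[0,1] e = subst (_≤ deficit ω e) (sumV-0 {n})
  (sumV-mono-≤ (λ v → 0≤* (𝟙-nonNeg (lookup e v)) (p≤q⇒0≤q-p _ _ (proj₂ (ω∈[0,1] v)))))

1-deficit≤prod : ∀ {n} (ω : Fin n → ℚ) → InUnitInterval ω → ∀ e → 1ℚ - deficit ω e ≤ prod ω e
1-deficit≤prod ω _ [] = ℚ.≤-refl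
1-deficit≤prod ω ω∈[0,1] (true ∷ e) =
  ≤-by-difference (1ℚ - ((1ℚ * (1ℚ - w)) + d)) (w * p) (w * (p - (1ℚ - d)) + d * (1ℚ - w))
    (solve 3 (λ w p d → (w :* p) :- (con 1ℚ :- ((con 1ℚ :* (con 1ℚ :- w)) :+ d))
                     := w :* (p :- (con 1ℚ :- d)) :+ d :* (con 1ℚ :- w)) refl w p d)
    (0≤+ (0≤* (proj₁ (ω∈[0,1] zero)) (p≤q⇒0≤q-p _ _ (1-deficit≤prod ω′ ω′∈[0,1] e)))
         (0≤* (deficit-nonNeg ω′ ω′∈[0,1] e) (p≤q⇒0≤q-p _ _ (proj₂ (ω∈[0,1] zero)))))
  where
  ω′ = λ i → ω (suc i)
  ω′∈[0,1] = λ i → ω∈[0,1] (suc i)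
  w = ω zero
  p = prod ω′ e
  d = deficit ω′ e
1-deficit≤prod ω ω∈[0,1] (false ∷ e) =
  ≤-by-difference (1ℚ - ((0ℚ * (1ℚ - ω zero)) + d)) (1ℚ * p) (p - (1ℚ - d))
    (solve 3 (λ w p d → (con 1ℚ :* p) :- (con 1ℚ :- ((con 0ℚ :* (con 1ℚ :- w)) :+ d)) := p :- (con 1ℚ :- d))
       refl (ω zero) p d)
    (p≤q⇒0≤q-p _ _ (1-deficit≤prod ω′ (λ i → ω∈[0,1] (suc i)) e))
  where
  ω′ = λ i → ω (suc i)
  p = prod ω′ e
  d = deficit ω′ e

countℚ-Δ*deficit≤sumOver-prod : ∀ {n} (H : SetSys n) (ω : Fin n → ℚ) → InUnitInterval ω →
  ∀ Δ → (∀ v → degℚ H v ≤ Δ) → countℚ H - Δ * sumV (λ v → 1ℚ - ω v) ≤ sumOver H (prod ω)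
countℚ-Δ*deficit≤sumOver-prod {n} H ω ω∈[0,1] Δ deg≤Δ = begin
  countℚ H - Δ * sumV (λ v → 1ℚ - ω v)
    ≤⟨ ℚ.+-monoʳ-≤ (countℚ H) (ℚ.neg-antimono-≤ ∑deficit≤) ⟩
  countℚ H - sumS deficitᴴ
    ≡⟨ sym (sumL-- (allSubsets n) (λ e → 𝟙 (H e)) deficitᴴ) ⟩
  sumS (λ e → 𝟙 (H e) - deficitᴴ e)
    ≤⟨ sumL-mono-≤ (allSubsets n) 1-deficit≤prod-if-edge ⟩
  sumOver H (prod ω) ∎
  where
  open ℚ.≤-Reasoning
  deficitᴴ : Subset n → ℚ
  deficitᴴ e = sumV (λ v → 𝟙 (H e ∧ lookup e v) * (1ℚ - ω v))
  1-deficit≤prod-if-edge : ∀ e → 𝟙 (H e) - deficitᴴ e ≤ (if H e then prod ω e else 0ℚ)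
  1-deficit≤prod-if-edge e with H e
  ... | true = 1-deficit≤prod ω ω∈[0,1] e
  ... | false = ℚ.≤-reflexive (cong (λ x → 0ℚ - x) (trans (sumV-cong (λ v → ℚ.*-zeroˡ (1ℚ - ω v))) (sumV-0 {n})))
  ∑deficit≤ : sumS deficitᴴ ≤ Δ * sumV (λ v → 1ℚ - ω v)
  ∑deficit≤ = subst₂ _≤_
    (sym (trans (sumL-sumV-comm (allSubsets n) (λ v e → 𝟙 (H e ∧ lookup e v) * (1ℚ - ω v)))
      (sumV-cong (λ v → sumL-*ʳ (allSubsets n) (λ e → 𝟙 (H e ∧ lookup e v)) (1ℚ - ω v)))))
    (sumV-*ˡ Δ (λ v → 1ℚ - ω v))
    (sumV-mono-≤ (λ v → *-monoʳ-≤-0≤ (p≤q⇒0≤q-p _ _ (proj₂ (ω∈[0,1] v))) (deg≤Δ v)))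

sumOver-*ʳ : ∀ {n} (H : SetSys n) (f : Subset n → ℚ) c → sumOver H (λ e → f e * c) ≡ sumOver H f * c
sumOver-*ʳ {n} H f c = trans (sumL-cong (allSubsets n) scale-if-edge)
  (sumL-*ʳ (allSubsets n) (λ e → if H e then f e else 0ℚ) c)
  where
  scale-if-edge : ∀ e → (if H e then f e * c else 0ℚ) ≡ (if H e then f e else 0ℚ) * c
  scale-if-edge e with H e
  ... | true = refl
  ... | false = sym (ℚ.*-zeroˡ c)

-- Each vertex v lies in at most 1/c edges, each carrying at most c·ωᵥ.
scaled-prod-isFracMatching : ∀ {n} (H : SetSys n) (ω : Fin n → ℚ) → InUnitInterval ω →
  ∀ c → 0ℚ ≤ c → c ≤ 1ℚ → (∀ v → degℚ H v * c ≤ 1ℚ) → IsFracMatching H ω (λ e → prod ω e * c)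
scaled-prod-isFracMatching {n} H ω ω∈[0,1] c 0≤c c≤1 deg*c≤1 = weight∈[0,1] , load≤ω
  where
  weight∈[0,1] : ∀ e → T (H e) → 0ℚ ≤ prod ω e * c × prod ω e * c ≤ 1ℚ
  weight∈[0,1] e _ with prod∈[0,1] ω ω∈[0,1] e
  ... | 0≤p , p≤1 = 0≤* 0≤p 0≤c ,
    ℚ.≤-trans (*-monoʳ-≤-0≤ 0≤c p≤1) (subst (_≤ 1ℚ) (sym (ℚ.*-identityˡ c)) c≤1)
  load≤ω : ∀ v → sumOver (λ e → H e ∧ (⁅ v ⁆ ⊆ᵇ e)) (λ e → prod ω e * c) ≤ ω v
  load≤ω v = begin
    sumOver (λ e → H e ∧ (⁅ v ⁆ ⊆ᵇ e)) (λ e → prod ω e * c)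
      ≡⟨ sumL-cong (allSubsets n) (λ e → cong (λ b → if H e ∧ b then prod ω e * c else 0ℚ) (⁅v⁆⊆ᵇe≡lookup v e)) ⟩
    sumOver (λ e → H e ∧ lookup e v) (λ e → prod ω e * c)
      ≤⟨ sumL-mono-≤ (allSubsets n) weight≤ωc ⟩
    sumS (λ e → 𝟙 (H e ∧ lookup e v) * (ω v * c))
      ≡⟨ sumL-*ʳ (allSubsets n) (λ e → 𝟙 (H e ∧ lookup e v)) (ω v * c) ⟩
    degℚ H v * (ω v * c)
      ≡⟨ solve 3 (λ d w c → d :* (w :* c) := w :* (d :* c)) refl (degℚ H v) (ω v) c ⟩
    ω v * (degℚ H v * c)
      ≤⟨ *-monoˡ-≤-0≤ (proj₁ (ω∈[0,1] v)) (deg*c≤1 v) ⟩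
    ω v * 1ℚ
      ≡⟨ ℚ.*-identityʳ (ω v) ⟩
    ω v ∎
    where
    open ℚ.≤-Reasoning
    weight≤ωc : ∀ e → (if H e ∧ lookup e v then prod ω e * c else 0ℚ) ≤ 𝟙 (H e ∧ lookup e v) * (ω v * c)
    weight≤ωc e with H e ∧ lookup e v in e∋v
    ... | true = subst (prod ω e * c ≤_) (sym (ℚ.*-identityˡ _))
        (*-monoʳ-≤-0≤ 0≤c (prod≤ω ω ω∈[0,1] e v (proj₂ (to (Bool.T-∧ {H e}) (from Bool.T-≡ e∋v)))))
    ... | false = ℚ.≤-reflexive (sym (ℚ.*-zeroˡ (ω v * c)))

-- The main estimate, for N = K + M vertices split between C and ∁ C

density⇒4e≥ : ∀ γ Cn e N → 2ℚ * Cn ≡ N * (N - 1ℚ) → (½ + γ) * Cn ≤ e →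
  (1ℚ + 2ℚ * γ) * (N * (N - 1ℚ)) ≤ 4ℚ * e
density⇒4e≥ γ Cn e N 2Cn≡N[N-1] Cn≤e = begin
  (1ℚ + 2ℚ * γ) * (N * (N - 1ℚ)) ≡⟨ cong ((1ℚ + 2ℚ * γ) *_) (sym 2Cn≡N[N-1]) ⟩
  (1ℚ + 2ℚ * γ) * (2ℚ * Cn)      ≡⟨ solve 2 (λ γ Cn → (con 1ℚ :+ con 2ℚ :* γ) :* (con 2ℚ :* Cn)
                                                   := con 4ℚ :* ((con ½ :+ γ) :* Cn)) refl γ Cn ⟩
  4ℚ * ((½ + γ) * Cn)             ≤⟨ *-monoˡ-≤-0≤ (ℕ→ℚ-nonNeg 4) Cn≤e ⟩
  4ℚ * e ∎
  where open ℚ.≤-Reasoning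

4e[C]≥ : ∀ γ e eC K M N → K + M ≡ N → (1ℚ + 2ℚ * γ) * (N * (N - 1ℚ)) ≤ 4ℚ * e → 4ℚ * e ≤ 4ℚ * eC + K * N →
  N * (M - 1ℚ) + 2ℚ * γ * (N * (N - 1ℚ)) ≤ 4ℚ * eC
4e[C]≥ γ e eC K M _ refl 4e≥ 4e≤ =
  ≤-by-difference _ _ ((4ℚ * e - (1ℚ + 2ℚ * γ) * (N * (N - 1ℚ))) + ((4ℚ * eC + K * N) - 4ℚ * e))
  (solve 5 (λ γ e eC K M → 
     (con 4ℚ :* eC) :- ((K :+ M) :* (M :- con 1ℚ) :+ con 2ℚ :* γ :* ((K :+ M) :* ((K :+ M) :- con 1ℚ)))
     := (con 4ℚ :* e :- (con 1ℚ :+ con 2ℚ :* γ) :* ((K :+ M) :* ((K :+ M) :- con 1ℚ)))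
        :+ ((con 4ℚ :* eC :+ K :* (K :+ M)) :- con 4ℚ :* e)) refl γ e eC K M)
  (0≤+ (p≤q⇒0≤q-p _ _ 4e≥) (p≤q⇒0≤q-p _ _ 4e≤))
  where N = K + M

0<M-1 : ∀ γ eC M N → N * (M - 1ℚ) + 2ℚ * γ * (N * (N - 1ℚ)) ≤ 4ℚ * eC → 2ℚ * eC ≤ N * (M - 1ℚ) →
  0ℚ < γ → 0ℚ < N → 0ℚ < N - 1ℚ → 0ℚ < M - 1ℚ
0<M-1 γ eC M N 4eC≥ 2eC≤ 0<γ 0<N 0<N-1 =
  ℚ.*-cancelˡ-<-nonNeg N {{nonNegative (ℚ.<⇒≤ 0<N)}}
    (ℚ.<-≤-trans (subst (_< 2ℚ * γ * (N * (N - 1ℚ))) (sym (ℚ.*-zeroʳ N)) 0<2γN[N-1]) 2γN[N-1]≤)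
  where
  0<2γN[N-1] : 0ℚ < 2ℚ * γ * (N * (N - 1ℚ))
  0<2γN[N-1] = 0<* (0<* (ℚ.positive⁻¹ 2ℚ) 0<γ) (0<* 0<N 0<N-1)
  2γN[N-1]≤ : 2ℚ * γ * (N * (N - 1ℚ)) ≤ N * (M - 1ℚ)
  2γN[N-1]≤ = ≤-by-difference _ _ ((4ℚ * eC - (N * (M - 1ℚ) + 2ℚ * γ * (N * (N - 1ℚ)))) + 2ℚ * (N * (M - 1ℚ) - 2ℚ * eC))
    (solve 4 (λ γ eC M N → N :* (M :- con 1ℚ) :- con 2ℚ :* γ :* (N :* (N :- con 1ℚ))
       := (con 4ℚ :* eC :- (N :* (M :- con 1ℚ) :+ con 2ℚ :* γ :* (N :* (N :- con 1ℚ))))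
          :+ con 2ℚ :* (N :* (M :- con 1ℚ) :- con 2ℚ :* eC)) refl γ eC M N)
    (0≤+ (p≤q⇒0≤q-p _ _ 4eC≥) (0≤* (ℕ→ℚ-nonNeg 2) (p≤q⇒0≤q-p _ _ 2eC≤)))

-- The deficit loss 4(M - 1)·ηN is paid for by the surplus 2γN(N - 1) since 4η ≤ γ and M ≤ N.
N[M-1]≤4S : ∀ γ η eC S D M N → N * (M - 1ℚ) + 2ℚ * γ * (N * (N - 1ℚ)) ≤ 4ℚ * eC →
  eC - (M - 1ℚ) * D ≤ S → D ≤ η * N → 4ℚ * η ≤ γ →
  0ℚ ≤ γ → 0ℚ ≤ N → 0ℚ ≤ N - 1ℚ → 0ℚ ≤ M - 1ℚ → M ≤ N → N * (M - 1ℚ) ≤ 4ℚ * S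
N[M-1]≤4S γ η eC S D M N 4eC≥ S≥ D≤ 4η≤γ 0≤γ 0≤N 0≤N-1 0≤M-1 M≤N = ≤-by-difference _ _
  (4ℚ * (S - (eC - (M - 1ℚ) * D)) + (4ℚ * eC - (N * (M - 1ℚ) + 2ℚ * γ * (N * (N - 1ℚ))))
   + 4ℚ * (M - 1ℚ) * (η * N - D) + (γ - 4ℚ * η) * (M - 1ℚ) * N + γ * N * (N - M) + γ * N * (N - 1ℚ))
  (solve 7 (λ γ η eC S D M N → con 4ℚ :* S :- N :* (M :- con 1ℚ)
     := con 4ℚ :* (S :- (eC :- (M :- con 1ℚ) :* D))
        :+ (con 4ℚ :* eC :- (N :* (M :- con 1ℚ) :+ con 2ℚ :* γ :* (N :* (N :- con 1ℚ))))
        :+ con 4ℚ :* (M :- con 1ℚ) :* (η :* N :- D) :+ (γ :- con 4ℚ :* η) :* (M :- con 1ℚ) :* N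
        :+ γ :* N :* (N :- M) :+ γ :* N :* (N :- con 1ℚ)) refl γ η eC S D M N)
  (0≤+ (0≤+ (0≤+ (0≤+ (0≤+
    (0≤* (ℕ→ℚ-nonNeg 4) (p≤q⇒0≤q-p _ _ S≥))
    (p≤q⇒0≤q-p _ _ 4eC≥))
    (0≤* (0≤* (ℕ→ℚ-nonNeg 4) 0≤M-1) (p≤q⇒0≤q-p _ _ D≤)))
    (0≤* (0≤* (p≤q⇒0≤q-p _ _ 4η≤γ) 0≤M-1) 0≤N))
    (0≤* (0≤* 0≤γ 0≤N) (p≤q⇒0≤q-p _ _ M≤N)))
    (0≤* (0≤* 0≤γ 0≤N) 0≤N-1))

1≤q⇒inverse∈[0,1] : ∀ q → 1ℚ ≤ q → Σ ℚ λ c → q * c ≡ 1ℚ × 0ℚ ≤ c × c ≤ 1ℚ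
1≤q⇒inverse∈[0,1] q 1≤q = 1/ q , ℚ.*-inverseʳ q , 0≤1/q , (begin
  1/ q        ≡⟨ sym (ℚ.*-identityˡ (1/ q)) ⟩
  1ℚ * 1/ q   ≤⟨ *-monoʳ-≤-0≤ 0≤1/q 1≤q ⟩
  q * 1/ q    ≡⟨ ℚ.*-inverseʳ q ⟩
  1ℚ ∎)
  where
  open ℚ.≤-Reasoning
  instance
    q-pos : Positive q
    q-pos = positive (ℚ.<-≤-trans (ℚ.positive⁻¹ 1ℚ) 1≤q)
    q-nonZero : NonZero q
    q-nonZero = ℚ.pos⇒nonZero q
  0≤1/q : 0ℚ ≤ 1/ q
  0≤1/q = ℚ.<⇒≤ (ℚ.positive⁻¹ (1/ q) {{ℚ.1/pos⇒pos q}})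

0<m-1⇒1≤m-1 : ∀ m → 0ℚ < ℕ→ℚ m - 1ℚ → 1ℚ ≤ ℕ→ℚ m - 1ℚ
0<m-1⇒1≤m-1 m 0<m-1 with m ℕ.≤? 1
... | yes m≤1 = ⊥-elim (ℚ.<-irrefl refl (ℚ.<-≤-trans 0<m-1 (ℚ.+-monoˡ-≤ (- 1ℚ) (ℕ→ℚ-mono-≤ m≤1))))
... | no m≰1 = p+1≤q⇒p≤q-1 1ℚ (ℕ→ℚ m) (ℕ→ℚ-mono-≤ (ℕ.≰⇒> m≰1))

total-deficit≤ηn : ∀ {n} (ω : Fin n → ℚ) η → (1ℚ - η) * ℕ→ℚ n ≤ sumV ω →
  sumV (λ v → 1ℚ - ω v) ≤ η * ℕ→ℚ n
total-deficit≤ηn {n} ω η ∑ω≥ = ≤-by-difference _ _ (sumV ω - (1ℚ - η) * ℕ→ℚ n)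
  (trans (cong (λ D → η * ℕ→ℚ n - D) (trans (sumV-+ (λ _ → 1ℚ) (λ v → - ω v)) (cong₂ _+_ (sumV-1 {n}) (sumV-neg ω))))
    (solve 3 (λ η N s → η :* N :- (N :+ (:- s)) := s :- (con 1ℚ :- η) :* N) refl η (ℕ→ℚ n) (sumV ω)))
  (p≤q⇒0≤q-p _ _ ∑ω≥)

largest-component-fractionalMatching : ∀ {n} (L : SetSys n) → Is2Graph L → ∀ γ η → 0ℚ < γ → 4ℚ * η ≤ γ →
  2 ≤ℕ n → (½ + γ) * ℕ→ℚ (n Comb.C 2) ≤ countℚ L →
  (ω : Fin n → ℚ) → InUnitInterval ω → (1ℚ - η) * ℕ→ℚ n ≤ sumV ω →
  (C : Subset n) → IsLargestComponent L C →
  Σ (Subset n → ℚ) λ ω* → IsFracMatching (induced L C) ω ω* × ℕ→ℚ n ≤ 4ℚ * fmSize (induced L C) ω*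
largest-component-fractionalMatching {n} L isGraph γ η 0<γ 4η≤γ 2≤n dense ω ω∈[0,1] ∑ω≥ C largest =
  (λ e → prod ω e * c) ,
  scaled-prod-isFracMatching L[C] ω ω∈[0,1] c 0≤c c≤1
    (λ v → ℚ.≤-trans (*-monoʳ-≤-0≤ 0≤c (degℚ-L[C]≤M-1 v)) (ℚ.≤-reflexive [M-1]c≡1)) ,
  (begin
    N                 ≡⟨ sym (trans (ℚ.*-assoc N (M - 1ℚ) c) (trans (cong (N *_) [M-1]c≡1) (ℚ.*-identityʳ N))) ⟩
    N * (M - 1ℚ) * c  ≤⟨ *-monoʳ-≤-0≤ 0≤c N[M-1]≤4S′ ⟩
    4ℚ * S * c        ≡⟨ trans (ℚ.*-assoc 4ℚ S c) (cong (4ℚ *_) (sym (sumOver-*ʳ L[C] (prod ω) c))) ⟩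
    4ℚ * fmSize L[C] (λ e → prod ω e * c) ∎)
  where
  open LargestComponent L isGraph C largest
  open ℚ.≤-Reasoning
  N S : ℚ
  N = ℕ→ℚ n
  S = sumOver L[C] (prod ω)
  1≤N-1 : 1ℚ ≤ N - 1ℚ
  1≤N-1 = p+1≤q⇒p≤q-1 1ℚ N (ℕ→ℚ-mono-≤ 2≤n)
  0<N-1 : 0ℚ < N - 1ℚ
  0<N-1 = ℚ.<-≤-trans (ℚ.positive⁻¹ 1ℚ) 1≤N-1
  4eC≥ : N * (M - 1ℚ) + 2ℚ * γ * (N * (N - 1ℚ)) ≤ 4ℚ * countℚ L[C]
  4eC≥ = 4e[C]≥ γ (countℚ L) (countℚ L[C]) K M N (∣∁C∣+∣C∣≡n C)
    (density⇒4e≥ γ (ℕ→ℚ (n Comb.C 2)) (countℚ L) N (2*nC2≡n*[n-1] n) dense) 4e≤4e[C]+Kn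
  1≤M-1 : 1ℚ ≤ M - 1ℚ
  1≤M-1 = 0<m-1⇒1≤m-1 ∣ C ∣ (0<M-1 γ (countℚ L[C]) M N 4eC≥ 2e[C]≤n[M-1] 0<γ
    (ℚ.<-≤-trans (ℚ.positive⁻¹ 2ℚ) (ℕ→ℚ-mono-≤ 2≤n)) 0<N-1)
  N[M-1]≤4S′ : N * (M - 1ℚ) ≤ 4ℚ * S
  N[M-1]≤4S′ = N[M-1]≤4S γ η (countℚ L[C]) S (sumV (λ v → 1ℚ - ω v)) M N 4eC≥
    (countℚ-Δ*deficit≤sumOver-prod L[C] ω ω∈[0,1] (M - 1ℚ) degℚ-L[C]≤M-1)
    (total-deficit≤ηn ω η ∑ω≥) 4η≤γ (ℚ.<⇒≤ 0<γ) (ℕ→ℚ-nonNeg n) (ℚ.<⇒≤ 0<N-1) (ℚ.≤-trans 0≤1 1≤M-1)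
    (ℕ→ℚ-mono-≤ (Subset.∣p∣≤n C))
  inverse : Σ ℚ λ c → (M - 1ℚ) * c ≡ 1ℚ × 0ℚ ≤ c × c ≤ 1ℚ
  inverse = 1≤q⇒inverse∈[0,1] (M - 1ℚ) 1≤M-1
  c : ℚ
  c = proj₁ inverse
  [M-1]c≡1 : (M - 1ℚ) * c ≡ 1ℚ
  [M-1]c≡1 = proj₁ (proj₂ inverse)
  0≤c : 0ℚ ≤ c
  0≤c = proj₁ (proj₂ (proj₂ inverse))
  c≤1 : c ≤ 1ℚ
  c≤1 = proj₂ (proj₂ (proj₂ inverse))

-- From the hypergraph to its link graph

shadow-size : ∀ {n k} (G : KGraph n k) j A → T (shadow G (ℕ.suc j) A) → ∣ A ∣ ≡ ℕ.suc j
shadow-size G j A A∈∂G = sym (ℕ.≡ᵇ⇒≡ (ℕ.suc j) ∣ A ∣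
  (subst T (==≡≡ᵇ (ℕ.suc j) ∣ A ∣) (proj₁ (to Bool.T-∧ A∈∂G))))

link-is2Graph : ∀ {n k} (G : KGraph n k) A → Is2Graph (link G A)
link-is2Graph G A e e∈L = trans (sym (==≡≡ᵇ 2 ∣ e ∣)) (to Bool.T-≡ (proj₁ (to Bool.T-∧ e∈L)))

minDeg⇒link-dense : ∀ {n k} (G : KGraph n (3 ℕ.+ k)) α δ → PerturbedMinDeg G α (ℕ.suc k) δ →
  ∀ A → T (shadow G (ℕ.suc k) A) → δ * ℕ→ℚ (n Comb.C 2) ≤ countℚ (link G A)
minDeg⇒link-dense {n} {k} G α δ minDeg A A∈∂G =
  subst₂ (λ j d → δ * ℕ→ℚ (n Comb.C j) ≤ d) k+3∸∣A∣≡2 (deg≡countℚ-link G A ∣A∣+2≡k+3)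
    (proj₁ (minDeg (ℕ.suc k) (ℕ.s≤s ℕ.z≤n) ℕ.≤-refl) A A∈∂G)
  where
  ∣A∣≡k+1 : ∣ A ∣ ≡ ℕ.suc k
  ∣A∣≡k+1 = shadow-size G k A A∈∂G
  ∣A∣+2≡k+3 : ∣ A ∣ ℕ.+ 2 ≡ 3 ℕ.+ k
  ∣A∣+2≡k+3 = trans (cong (ℕ._+ 2) ∣A∣≡k+1) (ℕ.+-comm (ℕ.suc k) 2)
  k+3∸∣A∣≡2 : (3 ℕ.+ k) ∸ ∣ A ∣ ≡ 2
  k+3∸∣A∣≡2 = trans (cong ((3 ℕ.+ k) ∸_) ∣A∣≡k+1) (ℕ.m+n∸n≡m 2 k)

¼ : ℚ
¼ = 1/ 4ℚ

proposition8p5 : (k : ℕ) → 4 ≤ℕ k →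
    Σ ℚ λ γ₀ → 0ℚ < γ₀ × ((γ : ℚ) → 0ℚ < γ → γ < γ₀ →
    Σ ℚ λ η₀ → 0ℚ < η₀ × ((η : ℚ) → 0ℚ < η → η < η₀ →
    Σ ℚ λ α₀ → 0ℚ < α₀ × ((α : ℚ) → 0ℚ < α → α < α₀ →
    Σ ℕ λ n₀ → (n : ℕ) → n₀ ≤ℕ n →
    (G : KGraph n k) → PerturbedMinDeg G α (k ∸ 2) (½ + γ) →
    (ω : Fin n → ℚ) → (∀ v → 0ℚ ≤ ω v × ω v ≤ 1ℚ) →
    (1ℚ - η) * ℕ→ℚ n ≤ sumV ω →
    (∀ v → Isolated G v → ω v ≡ 0ℚ) →
    (A : Subset n) → T (shadow G (k ∸ 2) A) →
    (C : Subset n) → IsLargestComponent (link G A) C →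
    Σ (Subset n → ℚ) λ ω* → IsFracMatching (induced (link G A) C) ω ω*
      × ℕ→ℚ n ≤ ℕ→ℚ 4 * fmSize (induced (link G A) C) ω*)))
proposition8p5 1 (ℕ.s≤s ())
proposition8p5 2 (ℕ.s≤s (ℕ.s≤s ()))
proposition8p5 3 (ℕ.s≤s (ℕ.s≤s (ℕ.s≤s ())))
proposition8p5 (ℕ.suc (ℕ.suc (ℕ.suc (ℕ.suc k)))) _ =
  1ℚ , ℚ.positive⁻¹ 1ℚ , λ γ 0<γ _ →
  γ * ¼ , 0<* 0<γ (ℚ.positive⁻¹ ¼) , λ η _ η<γ/4 →
  1ℚ , ℚ.positive⁻¹ 1ℚ , λ α _ _ →
  2 , λ n 2≤n G minDeg ω ω∈[0,1] ∑ω≥ _ A A∈∂G C largest →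
  largest-component-fractionalMatching (link G A) (link-is2Graph G A) γ η 0<γ (4η≤γ γ η η<γ/4) 2≤n
    (minDeg⇒link-dense G α (½ + γ) minDeg A A∈∂G) ω ω∈[0,1] ∑ω≥ C largest
  where
  4η≤γ : ∀ γ η → η < γ * ¼ → 4ℚ * η ≤ γ
  4η≤γ γ η η<γ/4 = ℚ.≤-trans (*-monoˡ-≤-0≤ (ℕ→ℚ-nonNeg 4) (ℚ.<⇒≤ η<γ/4))
    (ℚ.≤-reflexive (solve 1 (λ γ → con 4ℚ :* (γ :* con ¼) := γ) refl γ))
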